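{- With all generating functions meaning $\sum_{n\ge0}a_nz^n$ for the indicated sequence $a_n$: $$\sum_n(2\text{ - }1)\mathcal{S}_n(2\text{ - }3\text{ - }1)z^n=z^2B^2C^3,\qquad \sum_n(1\text{ - }2)\mathcal{S}_n(2\text{ - }3\text{ - }1)z^n=z^2B^3C^2;$$ for all $n\ge1$, $$(21)\mathcal{S}_n(2\text{ - }3\text{ - }1)=(12)\mathcal{S}_n(2\text{ - }3\text{ - }1)=[2\text{ - }1)\mathcal{S}_n(2\text{ - }3\text{ - }1)=[1\text{ - }2)\mathcal{S}_n(2\text{ - }3\text{ - }1)=\binom{2n-1}{n-2},$$ with common generating function $z^2BC^3$; and $$\sum_n[21)\mathcal{S}_n(2\text{ - }3\text{ - }1)z^n=z^2C^3,\qquad \sum_n[12)\mathcal{S}_n(2\text{ - }3\text{ - }1)z^n=z^2C^2.$$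
   Context: $\mathcal{S}_n$ is the set of permutations of $\{1,\dots,n\}$; $\mathcal{S}_n(2\text{ - }3\text{ - }1)$ is the set of $\sigma\in\mathcal{S}_n$ with no $i<j<k$ such that $\sigma_k<\sigma_i<\sigma_j$. For a vincular pattern $\tau$ (a permutation with dashes possibly between adjacent letters), an occurrence in $\pi$ is a subsequence order-isomorphic to $\tau$ whose entries corresponding to adjacent letters of $\tau$ not separated by a dash are in adjacent positions of $\pi$. Thus $(2\text{ - }1)\pi$ is the number of inversions, $(21)\pi$ the number of descents $\pi_i>\pi_{i+1}$, $(12)\pi$ the number of ascents. $(\tau)\pi$ is the number of occurrences, $[\tau)\pi$ the number of occurrences in which the first letter of $\tau$ is played by the first entry $\pi_1$; for a set $S$ these are summed over $\pi\in S$. $B=\frac{1}{\sqrt{1-4z}}$, $C=\frac{1-\sqrt{1-4z}}{2z}$. -}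

module Defs where

open import Data.Nat using (ℕ; zero; suc; _+_; _*_; _∸_; _^_; _<ᵇ_; _≡ᵇ_)
open import Data.Nat.Combinatorics using (_C_)
open import Data.Bool using (Bool; true; false; if_then_else_; _∧_; not)
open import Data.List using (List; []; _∷_; map; filter; length; concatMap; upTo; applyUpTo)
open import Data.Nat.ListAction using (sum)
open import Data.Bool.ListAction using (any)
open import Relation.Nullary.Decidable using (does)
open import Relation.Binary.PropositionalEquality using (_≡_)
open import Data.Bool using (T)
open import Data.Bool.Properties using (T?)

-- Permutations of {1,…,n} as lists (one-line notation σ₁ σ₂ … σₙ)

words : ℕ → ℕ → List (List ℕ)
words zero    n = [] ∷ []
words (suc k) n = concatMap (λ w → map (λ a → a ∷ w) (applyUpTo suc n)) (words k n)

distinct : List ℕ → Bool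
distinct []       = true
distinct (x ∷ xs) = not (any (λ y → x ≡ᵇ y) xs) ∧ distinct xs

Perm : ℕ → List (List ℕ)
Perm n = filter (λ w → T? (distinct w)) (words n n)

countB : (ℕ → Bool) → List ℕ → ℕ
countB p xs = length (filter (λ y → T? (p y)) xs)

-- (2-3-1)π : triples i<j<k with π_k < π_i < π_j
-- helper: for fixed first letter x, pairs j<k in ys with ys_k < x < ys_j
pairs31 : ℕ → List ℕ → ℕ
pairs31 x []       = 0
pairs31 x (y ∷ ys) = (if x <ᵇ y then countB (λ z → z <ᵇ x) ys else 0) + pairs31 x ys

occ2-3-1 : List ℕ → ℕ
occ2-3-1 []       = 0
occ2-3-1 (x ∷ xs) = pairs31 x xs + occ2-3-1 xs

occ2-1 : List ℕ → ℕ
occ2-1 []       = 0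
occ2-1 (x ∷ xs) = countB (λ y → y <ᵇ x) xs + occ2-1 xs

occ1-2 : List ℕ → ℕ
occ1-2 []       = 0
occ1-2 (x ∷ xs) = countB (λ y → x <ᵇ y) xs + occ1-2 xs

occ21 : List ℕ → ℕ
occ21 []           = 0
occ21 (x ∷ [])     = 0
occ21 (x ∷ y ∷ xs) = (if y <ᵇ x then 1 else 0) + occ21 (y ∷ xs)

occ12 : List ℕ → ℕ
occ12 []           = 0
occ12 (x ∷ [])     = 0
occ12 (x ∷ y ∷ xs) = (if x <ᵇ y then 1 else 0) + occ12 (y ∷ xs)

-- [2-1)π : occurrences of 2-1 whose 2 is π₁
first2-1 : List ℕ → ℕ
first2-1 []       = 0
first2-1 (x ∷ xs) = countB (λ y → y <ᵇ x) xs

first1-2 : List ℕ → ℕ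
first1-2 []       = 0
first1-2 (x ∷ xs) = countB (λ y → x <ᵇ y) xs

first21 : List ℕ → ℕ
first21 (x ∷ y ∷ xs) = if y <ᵇ x then 1 else 0
first21 _            = 0

first12 : List ℕ → ℕ
first12 (x ∷ y ∷ xs) = if x <ᵇ y then 1 else 0
first12 _            = 0

Av231 : ℕ → List (List ℕ)
Av231 n = filter (λ w → T? (occ2-3-1 w ≡ᵇ 0)) (Perm n)

-- (τ)𝒮ₙ(2-3-1) : statistic summed over the class
total : (List ℕ → ℕ) → ℕ → ℕ
total f n = sum (map f (Av231 n))

Series : Set
Series = ℕ → ℕ

infixl 7 _⊛_
_⊛_ : Series → Series → Series
(f ⊛ g) n = sum (map (λ i → f i * g (n ∸ i)) (upTo (suc n)))

one : Series
one zero    = 1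
one (suc _) = 0

Z : Series
Z n = if n ≡ᵇ 1 then 1 else 0

Z² : Series
Z² n = if n ≡ᵇ 2 then 1 else 0

infixl 6 _⊕_
_⊕_ : Series → Series → Series
(f ⊕ g) n = f n + g n

-- B = 1/√(1-4z): the series with constant term 1 whose square is 1/(1-4z) = Σ 4ⁿ zⁿ
IsB : Series → Set
IsB b = (b 0 ≡ 1) × ((n : ℕ) → (b ⊛ b) n ≡ 4 ^ n)
  where open import Data.Product using (_×_)

-- C = (1-√(1-4z))/(2z): the (unique) series satisfying C = 1 + z C²
IsC : Series → Set
IsC c = (n : ℕ) → c n ≡ (one ⊕ Z ⊛ c ⊛ c) n

-- binom(2n-1, n-2) with the convention that it is 0 for n < 2
bin : ℕ → ℕ
bin zero                = 0
bin (suc zero)          = 0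
bin (suc (suc m))       = (2 * m + 3) C m

-- Every nonempty 231-avoiding permutation factors uniquely as (k+1) α β′, where α is a
-- 231-avoiding permutation of {1,…,k} and β′ is a 231-avoiding permutation of {1,…,m}
-- with all entries raised by k+1 (once an entry exceeds the first one, all later entries
-- must exceed it too, or a 2-3-1 appears).  Each statistic of (k+1) α β′ is a weight depending
-- only on k and m plus the statistic on α and on β.  Summing over the factorisation, the
-- count satisfies C = 1 + zC², and every other total X satisfies X = zQ + 2zCX (or X = zQ
-- for the first-letter statistics) for an explicit Q.  These equations are guarded, hence
-- have unique solutions, which are found using B = 1 + 2zCB, z C′ = zBC² and B = C + zBC²,
-- all consequences of C = 1 + zC² and B² = 1/(1 - 4z).  Finally [zⁿ] B Cᵏ = binom(2n+k, n).

module Submission where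

open import Defs
open import Level using (0ℓ)
open import Data.Nat using (ℕ; zero; suc; _+_; _*_; _∸_; _^_; _≤_; _<_; z≤n; s≤s; _<ᵇ_; _≡ᵇ_; _≟_; _<?_)
open import Data.Nat.Properties
open import Data.Nat.Combinatorics using (_C_; nCk+nC[k+1]≡[n+1]C[k+1]; nCk≡nC[n∸k])
open import Data.Nat.ListAction using (sum)
open import Data.Nat.ListAction.Properties using (sum-++; sum-↭)
import Data.Nat.Solver as ℕ-Solver
open ℕ-Solver.+-*-Solver using () renaming (solve to ℕ-solve; _:+_ to _+ℕ_; _:*_ to _*ℕ_; _:=_ to _=ℕ_; con to conℕ)
open import Data.Bool using (Bool; true; false; T; not; if_then_else_)
open import Data.Bool.Properties using (T?; T-∧)
open import Data.Bool.ListAction using (any)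
open import Data.Unit using (tt)
open import Data.Empty using (⊥-elim)
open import Data.Product using (_×_; _,_; proj₁; proj₂; ∃-syntax)
open import Data.Sum using (inj₁; inj₂)
open import Data.Maybe.Relation.Unary.All as Maybe using (just)
open import Data.List using (List; []; _∷_; _++_; map; filter; length; head; concatMap; applyUpTo; upTo; takeWhile; dropWhile)
open import Data.List.Properties
  using (map-applyUpTo; filter-++; filter-all; filter-none; length-++; length-filter; length-applyUpTo; length-map;
         ∷-injectiveˡ; ∷-injectiveʳ; map-∘; map-id-local; takeWhile++dropWhile; map-++; ++-cancelˡ; map-injective)
open import Data.List.Membership.Propositional using (_∈_; find; lose)
open import Data.List.Membership.Propositional.Properties
open import Data.List.Membership.DecPropositional _≟_ using (_∈?_)
open import Data.List.Relation.Unary.Any using (here; there)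
open import Data.List.Relation.Unary.All as All using (All; []; _∷_)
import Data.List.Relation.Unary.All.Properties as All
open import Data.List.Relation.Unary.Unique.Propositional using (Unique; []; _∷_)
import Data.List.Relation.Unary.Unique.Propositional.Properties as Unique
open import Data.List.Relation.Binary.Permutation.Propositional using (_↭_)
import Data.List.Relation.Binary.Permutation.Propositional.Properties as ↭
open import Data.List.Membership.Propositional.Properties.WithK using (unique∧set⇒bag)
open import Data.List.Relation.Binary.BagAndSetEquality using (∼bag⇒↭)
open import Relation.Nullary using (¬_)
open import Relation.Binary.PropositionalEquality
open import Relation.Binary.Structures using (IsEquivalence)
import Relation.Binary.Reasoning.Setoid as SetoidReasoning
open import Function.Bundles using (mk⇔; Equivalence)
open import Algebra.Bundles using (CommutativeSemiring)

-- Formal power series over ℕ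

infix 4 _≈_
_≈_ : Series → Series → Set
f ≈ g = ∀ n → f n ≡ g n

zeroₛ : Series
zeroₛ _ = 0

shift : Series → Series
shift f n = f (suc n)

infixr 8 _⊙_
_⊙_ : (ℕ → ℕ) → Series → Series
(w ⊙ f) n = w n * f n

⊛-head : ∀ f g → (f ⊛ g) 0 ≡ f 0 * g 0
⊛-head f g = +-identityʳ _

⊛-suc : ∀ f g n → (f ⊛ g) (suc n) ≡ f 0 * g (suc n) + (shift f ⊛ g) n
⊛-suc f g n = cong (f 0 * g (suc n) +_) (trans
  (cong sum (map-applyUpTo suc (λ i → f i * g (suc n ∸ i)) (suc n)))
  (sym (cong sum (map-applyUpTo (λ i → i) (λ i → f (suc i) * g (n ∸ i)) (suc n)))))

⊛-cong : ∀ {f f′ g g′ : Series} → f ≈ f′ → g ≈ g′ → f ⊛ g ≈ f′ ⊛ g′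
⊛-cong p q zero    = cong₂ (λ a b → a * b + 0) (p 0) (q 0)
⊛-cong {f} {f′} {g} {g′} p q (suc n) = begin
  (f ⊛ g) (suc n)                     ≡⟨ ⊛-suc f g n ⟩
  f 0 * g (suc n) + (shift f ⊛ g) n     ≡⟨ cong₂ _+_ (cong₂ _*_ (p 0) (q (suc n))) (⊛-cong (λ k → p (suc k)) q n) ⟩
  f′ 0 * g′ (suc n) + (shift f′ ⊛ g′) n ≡⟨ ⊛-suc f′ g′ n ⟨
  (f′ ⊛ g′) (suc n)                   ∎
  where open ≡-Reasoning

⊛-zeroˡ : ∀ g → zeroₛ ⊛ g ≈ zeroₛ
⊛-zeroˡ g zero    = refl
⊛-zeroˡ g (suc n) = trans (⊛-suc zeroₛ g n) (⊛-zeroˡ g n)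

⊛-identityˡ : ∀ g → one ⊛ g ≈ g
⊛-identityˡ g zero    = trans (+-identityʳ _) (+-identityʳ _)
⊛-identityˡ g (suc n) = trans (⊛-suc one g n) (trans (cong₂ _+_ (+-identityʳ _) (⊛-zeroˡ g n)) (+-identityʳ _))

⊛-distribʳ : ∀ f g h → (f ⊕ g) ⊛ h ≈ f ⊛ h ⊕ g ⊛ h
⊛-distribʳ f g h zero = begin
  (f 0 + g 0) * h 0 + 0 ≡⟨ +-identityʳ _ ⟩
  (f 0 + g 0) * h 0     ≡⟨ *-distribʳ-+ (h 0) (f 0) (g 0) ⟩
  f 0 * h 0 + g 0 * h 0 ≡⟨ cong₂ _+_ (⊛-head f h) (⊛-head g h) ⟨
  (f ⊛ h) 0 + (g ⊛ h) 0 ∎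
  where open ≡-Reasoning
⊛-distribʳ f g h (suc n) = begin
  ((f ⊕ g) ⊛ h) (suc n)
    ≡⟨ ⊛-suc (f ⊕ g) h n ⟩
  (f 0 + g 0) * h (suc n) + (shift (f ⊕ g) ⊛ h) n
    ≡⟨ cong ((f 0 + g 0) * h (suc n) +_) (⊛-distribʳ (shift f) (shift g) h n) ⟩
  (f 0 + g 0) * h (suc n) + ((shift f ⊛ h) n + (shift g ⊛ h) n)
    ≡⟨ ℕ-solve 5 (λ x y z u v → (x +ℕ y) *ℕ z +ℕ (u +ℕ v) =ℕ (x *ℕ z +ℕ u) +ℕ (y *ℕ z +ℕ v))
                 refl (f 0) (g 0) (h (suc n)) _ _ ⟩
  (f 0 * h (suc n) + (shift f ⊛ h) n) + (g 0 * h (suc n) + (shift g ⊛ h) n)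
    ≡⟨ cong₂ _+_ (⊛-suc f h n) (⊛-suc g h n) ⟨
  (f ⊛ h) (suc n) + (g ⊛ h) (suc n) ∎
  where open ≡-Reasoning

⊛-scalarˡ : ∀ k f g → (λ _ → k) ⊙ f ⊛ g ≈ (λ _ → k) ⊙ (f ⊛ g)
⊛-scalarˡ k f g zero = trans (⊛-head ((λ _ → k) ⊙ f) g) (trans (*-assoc k (f 0) (g 0)) (cong (k *_) (sym (⊛-head f g))))
⊛-scalarˡ k f g (suc n) = begin
  ((λ _ → k) ⊙ f ⊛ g) (suc n)                       ≡⟨ ⊛-suc ((λ _ → k) ⊙ f) g n ⟩
  k * f 0 * g (suc n) + ((λ _ → k) ⊙ shift f ⊛ g) n ≡⟨ cong₂ _+_ (*-assoc k (f 0) _) (⊛-scalarˡ k (shift f) g n) ⟩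
  k * (f 0 * g (suc n)) + k * (shift f ⊛ g) n       ≡⟨ *-distribˡ-+ k _ _ ⟨
  k * (f 0 * g (suc n) + (shift f ⊛ g) n)           ≡⟨ cong (k *_) (⊛-suc f g n) ⟨
  k * (f ⊛ g) (suc n)                               ∎
  where open ≡-Reasoning

⊛-assoc : ∀ f g h → (f ⊛ g) ⊛ h ≈ f ⊛ (g ⊛ h)
⊛-assoc f g h zero = begin
  ((f ⊛ g) ⊛ h) 0   ≡⟨ ⊛-head (f ⊛ g) h ⟩
  (f ⊛ g) 0 * h 0   ≡⟨ cong (_* h 0) (⊛-head f g) ⟩
  f 0 * g 0 * h 0   ≡⟨ *-assoc (f 0) _ _ ⟩
  f 0 * (g 0 * h 0) ≡⟨ cong (f 0 *_) (⊛-head g h) ⟨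
  f 0 * (g ⊛ h) 0   ≡⟨ ⊛-head f (g ⊛ h) ⟨
  (f ⊛ (g ⊛ h)) 0   ∎
  where open ≡-Reasoning
⊛-assoc f g h (suc n) = begin
  ((f ⊛ g) ⊛ h) (suc n)
    ≡⟨ ⊛-suc (f ⊛ g) h n ⟩
  (f ⊛ g) 0 * h (suc n) + (shift (f ⊛ g) ⊛ h) n
    ≡⟨ cong₂ _+_ (cong (_* h (suc n)) (⊛-head f g)) (⊛-cong {g = h} (⊛-suc f g) (λ _ → refl) n) ⟩
  f 0 * g 0 * h (suc n) + (((λ _ → f 0) ⊙ shift g ⊕ shift f ⊛ g) ⊛ h) n
    ≡⟨ cong (f 0 * g 0 * h (suc n) +_) (⊛-distribʳ ((λ _ → f 0) ⊙ shift g) (shift f ⊛ g) h n) ⟩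
  f 0 * g 0 * h (suc n) + (((λ _ → f 0) ⊙ shift g ⊛ h) n + ((shift f ⊛ g) ⊛ h) n)
    ≡⟨ cong₂ (λ u v → f 0 * g 0 * h (suc n) + (u + v)) (⊛-scalarˡ (f 0) (shift g) h n) (⊛-assoc (shift f) g h n) ⟩
  f 0 * g 0 * h (suc n) + (f 0 * (shift g ⊛ h) n + (shift f ⊛ (g ⊛ h)) n)
    ≡⟨ ℕ-solve 5 (λ x y z u v → x *ℕ y *ℕ z +ℕ (x *ℕ u +ℕ v) =ℕ x *ℕ (y *ℕ z +ℕ u) +ℕ v)
                 refl (f 0) (g 0) (h (suc n)) _ _ ⟩
  f 0 * (g 0 * h (suc n) + (shift g ⊛ h) n) + (shift f ⊛ (g ⊛ h)) n
    ≡⟨ cong (λ t → f 0 * t + (shift f ⊛ (g ⊛ h)) n) (⊛-suc g h n) ⟨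
  f 0 * (g ⊛ h) (suc n) + (shift f ⊛ (g ⊛ h)) n
    ≡⟨ ⊛-suc f (g ⊛ h) n ⟨
  (f ⊛ (g ⊛ h)) (suc n) ∎
  where open ≡-Reasoning

⊛-comm : ∀ f g → f ⊛ g ≈ g ⊛ f
⊛-comm f g zero = trans (⊛-head f g) (trans (*-comm (f 0) (g 0)) (sym (⊛-head g f)))
⊛-comm f g (suc zero) = begin
  (f ⊛ g) 1                       ≡⟨ ⊛-suc f g 0 ⟩
  f 0 * g 1 + (shift f ⊛ g) 0     ≡⟨ cong (f 0 * g 1 +_) (⊛-head (shift f) g) ⟩
  f 0 * g 1 + f 1 * g 0           ≡⟨ +-comm (f 0 * g 1) _ ⟩
  f 1 * g 0 + f 0 * g 1           ≡⟨ cong₂ _+_ (*-comm (f 1) (g 0)) (*-comm (f 0) (g 1)) ⟩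
  g 0 * f 1 + g 1 * f 0           ≡⟨ cong (g 0 * f 1 +_) (⊛-head (shift g) f) ⟨
  g 0 * f 1 + (shift g ⊛ f) 0     ≡⟨ ⊛-suc g f 0 ⟨
  (g ⊛ f) 1                       ∎
  where open ≡-Reasoning
⊛-comm f g (suc (suc n)) = begin
  (f ⊛ g) (suc (suc n))
    ≡⟨ ⊛-suc f g (suc n) ⟩
  f 0 * g (2 + n) + (shift f ⊛ g) (suc n)
    ≡⟨ cong (f 0 * g (2 + n) +_) (trans (⊛-comm (shift f) g (suc n)) (⊛-suc g (shift f) n)) ⟩
  f 0 * g (2 + n) + (g 0 * f (2 + n) + (shift g ⊛ shift f) n)
    ≡⟨ cong (λ t → f 0 * g (2 + n) + (g 0 * f (2 + n) + t)) (⊛-comm (shift g) (shift f) n) ⟩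
  f 0 * g (2 + n) + (g 0 * f (2 + n) + (shift f ⊛ shift g) n)
    ≡⟨ ℕ-solve 3 (λ x y z → x +ℕ (y +ℕ z) =ℕ y +ℕ (x +ℕ z)) refl (f 0 * g (2 + n)) (g 0 * f (2 + n)) _ ⟩
  g 0 * f (2 + n) + (f 0 * g (2 + n) + (shift f ⊛ shift g) n)
    ≡⟨ cong (g 0 * f (2 + n) +_) (trans (⊛-comm (shift g) f (suc n)) (⊛-suc f (shift g) n)) ⟨
  g 0 * f (2 + n) + (shift g ⊛ f) (suc n)
    ≡⟨ ⊛-suc g f (suc n) ⟨
  (g ⊛ f) (suc (suc n)) ∎
  where open ≡-Reasoning

series : CommutativeSemiring 0ℓ 0ℓ
series = record
  { Carrier = Series ; _≈_ = _≈_ ; _+_ = _⊕_ ; _*_ = _⊛_ ; 0# = zeroₛ ; 1# = one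
  ; isCommutativeSemiring = record
    { isSemiring = record
      { isSemiringWithoutAnnihilatingZero = record
        { +-isCommutativeMonoid = record
          { isMonoid = record
            { isSemigroup = record
              { isMagma = record
                { isEquivalence = ≈-isEquivalence
                ; ∙-cong = λ p q n → cong₂ _+_ (p n) (q n) }
              ; assoc = λ f g h n → +-assoc (f n) (g n) (h n) }
            ; identity = (λ f n → refl) , (λ f n → +-identityʳ (f n)) }
          ; comm = λ f g n → +-comm (f n) (g n) }
        ; *-cong = ⊛-cong
        ; *-assoc = ⊛-assoc
        ; *-identity = ⊛-identityˡ , (λ f n → trans (⊛-comm f one n) (⊛-identityˡ f n))
        ; distrib = (λ f g h n → trans (⊛-comm f (g ⊕ h) n)
                      (trans (⊛-distribʳ g h f n) (cong₂ _+_ (⊛-comm g f n) (⊛-comm h f n))))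
                  , (λ h f g → ⊛-distribʳ f g h) }
      ; zero = ⊛-zeroˡ , (λ f n → trans (⊛-comm f zeroₛ n) (⊛-zeroˡ f n)) }
    ; *-comm = ⊛-comm } }
  where
  ≈-isEquivalence : IsEquivalence _≈_
  ≈-isEquivalence = record
    { refl = λ _ → refl ; sym = λ p n → sym (p n) ; trans = λ p q n → trans (p n) (q n) }

open import Algebra.Solver.Ring.NaturalCoefficients.Default series
open CommutativeSemiring series using (+-cong; *-cong)
  renaming (setoid to series-setoid; refl to ≈-refl; sym to ≈-sym; trans to ≈-trans)

module ≈-Reasoning = SetoidReasoning series-setoid

⊕-congˡ : ∀ {f f′} g → f ≈ f′ → f ⊕ g ≈ f′ ⊕ g
⊕-congˡ g p n = cong (_+ g n) (p n)

⊕-congʳ : ∀ f {g g′} → g ≈ g′ → f ⊕ g ≈ f ⊕ g′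
⊕-congʳ f p n = cong (f n +_) (p n)

⊛-congˡ : ∀ {f f′} g → f ≈ f′ → f ⊛ g ≈ f′ ⊛ g
⊛-congˡ g p = ⊛-cong {g = g} p (λ _ → refl)

⊛-congʳ : ∀ f {g g′} → g ≈ g′ → f ⊛ g ≈ f ⊛ g′
⊛-congʳ f p = ⊛-cong {f = f} (λ _ → refl) p

⊕-cancelʳ : ∀ {f g} h → f ⊕ h ≈ g ⊕ h → f ≈ g
⊕-cancelʳ {f} {g} h p n = +-cancelʳ-≡ (h n) (f n) (g n) (p n)

⊙-cong : ∀ w {f g} → f ≈ g → w ⊙ f ≈ w ⊙ g
⊙-cong w p n = cong (w n *_) (p n)

Z⊛-suc : ∀ h n → (Z ⊛ h) (suc n) ≡ h n
Z⊛-suc h n = trans (⊛-suc Z h n) (trans (⊛-cong {g = h} shift-Z (λ _ → refl) n) (⊛-identityˡ h n))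
  where
  shift-Z : shift Z ≈ one
  shift-Z zero    = refl
  shift-Z (suc n) = refl

Z²≈Z⊛Z : Z² ≈ Z ⊛ Z
Z²≈Z⊛Z zero    = refl
Z²≈Z⊛Z (suc n) = sym (trans (Z⊛-suc Z n) (Z≡shift-Z² n))
  where
  Z≡shift-Z² : ∀ n → Z n ≡ Z² (suc n)
  Z≡shift-Z² zero          = refl
  Z≡shift-Z² (suc zero)    = refl
  Z≡shift-Z² (suc (suc n)) = refl

-- the Euler operator z d/dz
θ : Series → Series
θ f = (λ n → n) ⊙ f

θ-one : θ one ≈ zeroₛ
θ-one zero    = refl
θ-one (suc n) = *-zeroʳ (suc n)

θ-Z : θ Z ≈ Z
θ-Z zero          = refl
θ-Z (suc zero)    = refl
θ-Z (suc (suc n)) = *-zeroʳ (suc (suc n))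

θ-⊕ : ∀ f g → θ (f ⊕ g) ≈ θ f ⊕ θ g
θ-⊕ f g n = *-distribˡ-+ n (f n) (g n)

θ-⊛ : ∀ f g → θ (f ⊛ g) ≈ θ f ⊛ g ⊕ f ⊛ θ g
θ-⊛ f g zero = sym (trans (cong₂ _+_ (⊛-head (θ f) g) (⊛-head f (θ g))) (*-zeroʳ (f 0)))
θ-⊛ f g (suc n) = begin
  suc n * (f ⊛ g) (suc n)
    ≡⟨ cong (suc n *_) (⊛-suc f g n) ⟩
  suc n * (f 0 * g (suc n) + U)
    ≡⟨ ℕ-solve 4 (λ m x y a → (conℕ 1 +ℕ m) *ℕ (x *ℕ y +ℕ a)
                           =ℕ (a +ℕ m *ℕ a) +ℕ x *ℕ ((conℕ 1 +ℕ m) *ℕ y)) refl n (f 0) (g (suc n)) U ⟩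
  (U + n * U) + f 0 * (suc n * g (suc n))
    ≡⟨ cong (λ t → (U + t) + f 0 * (suc n * g (suc n))) (θ-⊛ (shift f) g n) ⟩
  (U + (V + W)) + f 0 * (suc n * g (suc n))
    ≡⟨ ℕ-solve 4 (λ a b c d → (a +ℕ (b +ℕ c)) +ℕ d =ℕ (a +ℕ b) +ℕ (d +ℕ c)) refl U V W _ ⟩
  (U + V) + (f 0 * (suc n * g (suc n)) + W)
    ≡⟨ cong₂ _+_ θf⊛g-suc (⊛-suc f (θ g) n) ⟨
  (θ f ⊛ g) (suc n) + (f ⊛ θ g) (suc n) ∎
  where
  open ≡-Reasoning
  U V W : ℕ
  U = (shift f ⊛ g) n
  V = (θ (shift f) ⊛ g) n
  W = (shift f ⊛ θ g) n
  -- shift (θ f) = shift f ⊕ θ (shift f) holds definitionally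
  θf⊛g-suc : (θ f ⊛ g) (suc n) ≡ U + V
  θf⊛g-suc = trans (⊛-suc (θ f) g n) (⊛-distribʳ (shift f) (θ (shift f)) g n)

-- Guarded equations x = P + z H(x)

AgreeUpTo : ℕ → Series → Series → Set
AgreeUpTo n x y = ∀ i → i ≤ n → x i ≡ y i

agree-refl : ∀ {n} x → AgreeUpTo n x x
agree-refl x _ _ = refl

agree-shift : ∀ {n x y} → AgreeUpTo (suc n) x y → AgreeUpTo n (shift x) (shift y)
agree-shift p i i≤n = p (suc i) (s≤s i≤n)

agree-≤ : ∀ {m n x y} → m ≤ n → AgreeUpTo n x y → AgreeUpTo m x y
agree-≤ m≤n p i i≤m = p i (≤-trans i≤m m≤n)

agree-zero : ∀ {x y} → x 0 ≡ y 0 → AgreeUpTo 0 x y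
agree-zero eq .0 z≤n = eq

agree-suc : ∀ {n x y} → AgreeUpTo n x y → x (suc n) ≡ y (suc n) → AgreeUpTo (suc n) x y
agree-suc p eq i i≤1+n with m≤n⇒m<n∨m≡n i≤1+n
... | inj₁ (s≤s i≤n) = p i i≤n
... | inj₂ refl      = eq

agree⇒≈ : ∀ {x y} → (∀ n → AgreeUpTo n x y) → x ≈ y
agree⇒≈ p n = p n n ≤-refl

⊛-agree-at : ∀ n {x x′ y y′} → AgreeUpTo n x x′ → AgreeUpTo n y y′ → (x ⊛ y) n ≡ (x′ ⊛ y′) n
⊛-agree-at zero    p q = cong₂ (λ a b → a * b + 0) (p 0 z≤n) (q 0 z≤n)
⊛-agree-at (suc n) {x} {x′} {y} {y′} p q = begin
  (x ⊛ y) (suc n)                         ≡⟨ ⊛-suc x y n ⟩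
  x 0 * y (suc n) + (shift x ⊛ y) n       ≡⟨ cong₂ _+_ (cong₂ _*_ (p 0 z≤n) (q (suc n) ≤-refl))
                                                       (⊛-agree-at n (agree-shift p) (agree-≤ (n≤1+n n) q)) ⟩
  x′ 0 * y′ (suc n) + (shift x′ ⊛ y′) n   ≡⟨ ⊛-suc x′ y′ n ⟨
  (x′ ⊛ y′) (suc n)                       ∎
  where open ≡-Reasoning

⊛-agree : ∀ {n x x′ y y′} → AgreeUpTo n x x′ → AgreeUpTo n y y′ → AgreeUpTo n (x ⊛ y) (x′ ⊛ y′)
⊛-agree p q i i≤n = ⊛-agree-at i (agree-≤ i≤n p) (agree-≤ i≤n q)

⊕-agree : ∀ {n x x′ y y′} → AgreeUpTo n x x′ → AgreeUpTo n y y′ → AgreeUpTo n (x ⊕ y) (x′ ⊕ y′)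
⊕-agree p q i i≤n = cong₂ _+_ (p i i≤n) (q i i≤n)

-- The n-th coefficient of H x depends only on x₀, …, xₙ, so x = P + z H x
-- determines x coefficient by coefficient.
Causal : (Series → Series) → Set
Causal H = ∀ n x y → AgreeUpTo n x y → H x n ≡ H y n

module _ (P : Series) (H : Series → Series) (H-causal : Causal H) where

  guarded-step : ∀ {n x y} → AgreeUpTo n x y → (P ⊕ Z ⊛ H x) (suc n) ≡ (P ⊕ Z ⊛ H y) (suc n)
  guarded-step {n} {x} {y} p = cong (P (suc n) +_)
    (trans (Z⊛-suc (H x) n) (trans (H-causal n x y p) (sym (Z⊛-suc (H y) n))))

  guarded-unique : ∀ {x y} → x ≈ P ⊕ Z ⊛ H x → y ≈ P ⊕ Z ⊛ H y → x ≈ y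
  guarded-unique {x} {y} hx hy = agree⇒≈ agree
    where
    agree : ∀ n → AgreeUpTo n x y
    agree zero    = agree-zero (trans (hx 0) (sym (hy 0)))
    agree (suc n) = agree-suc (agree n) (trans (hx (suc n)) (trans (guarded-step (agree n)) (sym (hy (suc n)))))

  private
    approximant : ℕ → Series
    approximant zero    = zeroₛ
    approximant (suc k) = P ⊕ Z ⊛ H (approximant k)

    approximant-stable : ∀ k l i → i < k → i < l → approximant k i ≡ approximant l i
    approximant-stable (suc k) (suc l) zero    _       _       = refl
    approximant-stable (suc k) (suc l) (suc i) (s≤s p) (s≤s q) = guarded-step
      (λ j j≤i → approximant-stable k l j (≤-<-trans j≤i p) (≤-<-trans j≤i q))

  guarded-solution : Series
  guarded-solution n = approximant (suc n) n

  guarded-solution-eq : guarded-solution ≈ P ⊕ Z ⊛ H guarded-solution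
  guarded-solution-eq zero    = refl
  guarded-solution-eq (suc n) = guarded-step
    (λ i i≤n → approximant-stable (suc n) (suc i) i (s≤s i≤n) (s≤s ≤-refl))

-- With w₀ = 1, the coefficient of z^(n+1) in w² is 2 w_(n+1) plus terms in w₁, …, wₙ.
private
  square-rest : Series → ℕ → ℕ
  square-rest w zero    = 0
  square-rest w (suc n) = (shift w ⊛ shift w) n

  square-suc : ∀ w → w 0 ≡ 1 → ∀ n → (w ⊛ w) (suc n) ≡ w (suc n) + (w (suc n) + square-rest w n)
  square-suc w w₀ zero = begin
    (w ⊛ w) 1                 ≡⟨ ⊛-suc w w 0 ⟩
    w 0 * w 1 + (w 1 * w 0 + 0) ≡⟨ cong (λ t → t * w 1 + (w 1 * t + 0)) w₀ ⟩
    1 * w 1 + (w 1 * 1 + 0)   ≡⟨ cong₂ (λ u v → u + (v + 0)) (*-identityˡ (w 1)) (*-identityʳ (w 1)) ⟩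
    w 1 + (w 1 + 0)           ∎
    where open ≡-Reasoning
  square-suc w w₀ (suc n) = begin
    (w ⊛ w) (2 + n)
      ≡⟨ ⊛-suc w w (suc n) ⟩
    w 0 * w (2 + n) + (shift w ⊛ w) (suc n)
      ≡⟨ cong ((w 0 * w (2 + n)) +_) (⊛-comm (shift w) w (suc n)) ⟩
    w 0 * w (2 + n) + (w ⊛ shift w) (suc n)
      ≡⟨ cong ((w 0 * w (2 + n)) +_) (⊛-suc w (shift w) n) ⟩
    w 0 * w (2 + n) + (w 0 * w (2 + n) + (shift w ⊛ shift w) n)
      ≡⟨ cong (λ t → t * w (2 + n) + (t * w (2 + n) + (shift w ⊛ shift w) n)) w₀ ⟩
    1 * w (2 + n) + (1 * w (2 + n) + (shift w ⊛ shift w) n)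
      ≡⟨ cong (λ u → u + (u + (shift w ⊛ shift w) n)) (*-identityˡ (w (2 + n))) ⟩
    w (2 + n) + (w (2 + n) + (shift w ⊛ shift w) n) ∎
    where open ≡-Reasoning

square-unique : ∀ {x y} → x 0 ≡ 1 → y 0 ≡ 1 → x ⊛ x ≈ y ⊛ y → x ≈ y
square-unique {x} {y} x₀ y₀ x²≈y² = agree⇒≈ agree
  where
  rest-agree : ∀ n → AgreeUpTo n x y → square-rest x n ≡ square-rest y n
  rest-agree zero    _ = refl
  rest-agree (suc n) p = ⊛-agree-at n (agree-shift p) (agree-shift p)
  double-cancel : ∀ a b → a + a ≡ b + b → a ≡ b
  double-cancel a b e = *-cancelˡ-≡ a b 2
    (trans (cong (a +_) (+-identityʳ a)) (trans e (sym (cong (b +_) (+-identityʳ b)))))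
  agree : ∀ n → AgreeUpTo n x y
  agree zero    = agree-zero (trans x₀ (sym y₀))
  agree (suc n) = agree-suc (agree n) (double-cancel _ _ (+-cancelʳ-≡ (square-rest x n) _ _ (begin
    x (suc n) + x (suc n) + square-rest x n   ≡⟨ +-assoc (x (suc n)) _ _ ⟩
    x (suc n) + (x (suc n) + square-rest x n) ≡⟨ square-suc x x₀ n ⟨
    (x ⊛ x) (suc n)                           ≡⟨ x²≈y² (suc n) ⟩
    (y ⊛ y) (suc n)                           ≡⟨ square-suc y y₀ n ⟩
    y (suc n) + (y (suc n) + square-rest y n) ≡⟨ cong (λ t → y (suc n) + (y (suc n) + t)) (rest-agree n (agree n)) ⟨
    y (suc n) + (y (suc n) + square-rest x n) ≡⟨ +-assoc (y (suc n)) _ _ ⟨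
    y (suc n) + y (suc n) + square-rest x n   ∎)))
    where open ≡-Reasoning

double-product-causal : ∀ c → Causal (λ x → c ⊛ x ⊕ c ⊛ x)
double-product-causal c n x y p = ⊕-agree (⊛-agree (agree-refl c) p) (⊛-agree (agree-refl c) p) n ≤-refl

module BCIdentities (b c : Series) (isB : IsB b) (isC : IsC c) where

  open ≈-Reasoning

  c-head : c 0 ≡ 1
  c-head = isC 0

  -- D solves D = 1 + 2zCD, i.e. D = 1/(1 - 2zC); D² = 1/(1 - 4z) follows from C = 1 + zC².
  private
    D : Series
    D = guarded-solution one (λ x → c ⊛ x ⊕ c ⊛ x) (double-product-causal c)

    D-eq : D ≈ one ⊕ Z ⊛ (c ⊛ D ⊕ c ⊛ D)
    D-eq = guarded-solution-eq one (λ x → c ⊛ x ⊕ c ⊛ x) (double-product-causal c)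

    D² : Series
    D² = D ⊛ D

    D²-eq₁ : D² ≈ D ⊕ Z ⊛ (c ⊛ D² ⊕ c ⊛ D²)
    D²-eq₁ = begin
      D ⊛ D
        ≈⟨ ⊛-congʳ D D-eq ⟩
      D ⊛ (one ⊕ Z ⊛ (c ⊛ D ⊕ c ⊛ D))
        ≈⟨ solve 3 (λ d z c → d :* (con 1 :+ z :* (c :* d :+ c :* d))
                           := d :+ z :* (c :* (d :* d) :+ c :* (d :* d))) ≈-refl D Z c ⟩
      D ⊕ Z ⊛ (c ⊛ D² ⊕ c ⊛ D²) ∎

    D²-eq₂ : D² ⊕ D² ≈ c ⊛ D ⊕ c ⊛ D²
    D²-eq₂ = ⊕-cancelʳ (c ⊛ D²) (begin
      (D² ⊕ D²) ⊕ c ⊛ D²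
        ≈⟨ ⊕-congʳ (D² ⊕ D²) (⊛-congʳ c D²-eq₁) ⟩
      (D² ⊕ D²) ⊕ c ⊛ (D ⊕ Z ⊛ (c ⊛ D² ⊕ c ⊛ D²))
        ≈⟨ solve 4 (λ c d z e → (e :+ e) :+ c :* (d :+ z :* (c :* e :+ c :* e))
                             := (c :* d :+ (con 1 :+ z :* c :* c) :* e) :+ (con 1 :+ z :* c :* c) :* e) ≈-refl c D Z D² ⟩
      (c ⊛ D ⊕ (one ⊕ Z ⊛ c ⊛ c) ⊛ D²) ⊕ (one ⊕ Z ⊛ c ⊛ c) ⊛ D²
        ≈⟨ +-cong (⊕-congʳ (c ⊛ D) (⊛-congˡ D² (≈-sym isC))) (⊛-congˡ D² (≈-sym isC)) ⟩
      (c ⊛ D ⊕ c ⊛ D²) ⊕ c ⊛ D² ∎)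

    D²-eq : D² ≈ one ⊕ Z ⊛ (D² ⊕ D² ⊕ D² ⊕ D²)
    D²-eq = begin
      D²
        ≈⟨ D²-eq₁ ⟩
      D ⊕ Z ⊛ (c ⊛ D² ⊕ c ⊛ D²)
        ≈⟨ ⊕-congˡ (Z ⊛ (c ⊛ D² ⊕ c ⊛ D²)) D-eq ⟩
      (one ⊕ Z ⊛ (c ⊛ D ⊕ c ⊛ D)) ⊕ Z ⊛ (c ⊛ D² ⊕ c ⊛ D²)
        ≈⟨ solve 4 (λ z c d e → (con 1 :+ z :* (c :* d :+ c :* d)) :+ z :* (c :* e :+ c :* e)
                             := con 1 :+ z :* ((c :* d :+ c :* e) :+ (c :* d :+ c :* e))) ≈-refl Z c D D² ⟩
      one ⊕ Z ⊛ ((c ⊛ D ⊕ c ⊛ D²) ⊕ (c ⊛ D ⊕ c ⊛ D²))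
        ≈⟨ ⊕-congʳ one (⊛-congʳ Z (+-cong (≈-sym D²-eq₂) (≈-sym D²-eq₂))) ⟩
      one ⊕ Z ⊛ ((D² ⊕ D²) ⊕ (D² ⊕ D²))
        ≈⟨ solve 2 (λ z e → con 1 :+ z :* ((e :+ e) :+ (e :+ e)) := con 1 :+ z :* (e :+ e :+ e :+ e)) ≈-refl Z D² ⟩
      one ⊕ Z ⊛ (D² ⊕ D² ⊕ D² ⊕ D²) ∎

    D²≡4^ : ∀ n → D² n ≡ 4 ^ n
    D²≡4^ zero    = D²-eq 0
    D²≡4^ (suc n) = trans (D²-eq (suc n)) (trans (Z⊛-suc (D² ⊕ D² ⊕ D² ⊕ D²) n)
      (trans (cong (λ t → t + t + t + t) (D²≡4^ n))
             (ℕ-solve 1 (λ x → x +ℕ x +ℕ x +ℕ x =ℕ conℕ 4 *ℕ x) refl (4 ^ n))))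

    b≈D : b ≈ D
    b≈D = square-unique (proj₁ isB) (D-eq 0) (λ n → trans (proj₂ isB n) (sym (D²≡4^ n)))

  b-eq : b ≈ one ⊕ Z ⊛ (c ⊛ b ⊕ c ⊛ b)
  b-eq = begin
    b                             ≈⟨ b≈D ⟩
    D                             ≈⟨ D-eq ⟩
    one ⊕ Z ⊛ (c ⊛ D ⊕ c ⊛ D)     ≈⟨ ⊕-congʳ one (⊛-congʳ Z (+-cong c⊛D≈c⊛b c⊛D≈c⊛b)) ⟩
    one ⊕ Z ⊛ (c ⊛ b ⊕ c ⊛ b)     ∎
    where
    c⊛D≈c⊛b : c ⊛ D ≈ c ⊛ b
    c⊛D≈c⊛b = ⊛-congʳ c (≈-sym b≈D)

  b≈c+zbc² : b ≈ c ⊕ Z ⊛ b ⊛ c ⊛ c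
  b≈c+zbc² = ⊕-cancelʳ b (begin
    b ⊕ b
      ≈⟨ ⊕-cancelʳ (c ⊛ b) 2b+cb≈c+2cb ⟩
    c ⊕ c ⊛ b
      ≈⟨ ⊕-congʳ c (⊛-congˡ b isC) ⟩
    c ⊕ (one ⊕ Z ⊛ c ⊛ c) ⊛ b
      ≈⟨ solve 3 (λ b c z → c :+ (con 1 :+ z :* c :* c) :* b := (c :+ z :* b :* c :* c) :+ b) ≈-refl b c Z ⟩
    (c ⊕ Z ⊛ b ⊛ c ⊛ c) ⊕ b ∎)
    where
    2b+cb≈c+2cb : (b ⊕ b) ⊕ c ⊛ b ≈ (c ⊕ c ⊛ b) ⊕ c ⊛ b
    2b+cb≈c+2cb = begin
      (b ⊕ b) ⊕ c ⊛ b
        ≈⟨ ⊕-congʳ (b ⊕ b) (⊛-congʳ c b-eq) ⟩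
      (b ⊕ b) ⊕ c ⊛ (one ⊕ Z ⊛ (c ⊛ b ⊕ c ⊛ b))
        ≈⟨ solve 3 (λ b c z → (b :+ b) :+ c :* (con 1 :+ z :* (c :* b :+ c :* b))
                           := (c :+ (con 1 :+ z :* c :* c) :* b) :+ (con 1 :+ z :* c :* c) :* b) ≈-refl b c Z ⟩
      (c ⊕ (one ⊕ Z ⊛ c ⊛ c) ⊛ b) ⊕ (one ⊕ Z ⊛ c ⊛ c) ⊛ b
        ≈⟨ +-cong (⊕-congʳ c (⊛-congˡ b (≈-sym isC))) (⊛-congˡ b (≈-sym isC)) ⟩
      (c ⊕ c ⊛ b) ⊕ c ⊛ b ∎

  -- Differentiating C = 1 + zC² gives θC = zC² + 2zC θC, an equation also solved by zBC².
  θc≈zbc² : θ c ≈ Z ⊛ b ⊛ c ⊛ c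
  θc≈zbc² = guarded-unique (Z ⊛ c ⊛ c) (λ x → c ⊛ x ⊕ c ⊛ x) (double-product-causal c) θc-eq zbc²-eq
    where
    θc-eq : θ c ≈ Z ⊛ c ⊛ c ⊕ Z ⊛ (c ⊛ θ c ⊕ c ⊛ θ c)
    θc-eq = begin
      θ c
        ≈⟨ ⊙-cong (λ n → n) isC ⟩
      θ (one ⊕ Z ⊛ c ⊛ c)
        ≈⟨ θ-⊕ one (Z ⊛ c ⊛ c) ⟩
      θ one ⊕ θ (Z ⊛ c ⊛ c)
        ≈⟨ +-cong θ-one (θ-⊛ (Z ⊛ c) c) ⟩
      zeroₛ ⊕ (θ (Z ⊛ c) ⊛ c ⊕ (Z ⊛ c) ⊛ θ c)
        ≈⟨ ⊕-congʳ zeroₛ (⊕-congˡ ((Z ⊛ c) ⊛ θ c) (⊛-congˡ c (θ-⊛ Z c))) ⟩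
      zeroₛ ⊕ ((θ Z ⊛ c ⊕ Z ⊛ θ c) ⊛ c ⊕ (Z ⊛ c) ⊛ θ c)
        ≈⟨ ⊕-congʳ zeroₛ (⊕-congˡ ((Z ⊛ c) ⊛ θ c) (⊛-congˡ c (⊕-congˡ (Z ⊛ θ c) (⊛-congˡ c θ-Z)))) ⟩
      zeroₛ ⊕ ((Z ⊛ c ⊕ Z ⊛ θ c) ⊛ c ⊕ (Z ⊛ c) ⊛ θ c)
        ≈⟨ solve 3 (λ z c k → con 0 :+ ((z :* c :+ z :* k) :* c :+ (z :* c) :* k)
                           := z :* c :* c :+ z :* (c :* k :+ c :* k)) ≈-refl Z c (θ c) ⟩
      Z ⊛ c ⊛ c ⊕ Z ⊛ (c ⊛ θ c ⊕ c ⊛ θ c) ∎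
    zbc²-eq : Z ⊛ b ⊛ c ⊛ c ≈ Z ⊛ c ⊛ c ⊕ Z ⊛ (c ⊛ (Z ⊛ b ⊛ c ⊛ c) ⊕ c ⊛ (Z ⊛ b ⊛ c ⊛ c))
    zbc²-eq = begin
      Z ⊛ b ⊛ c ⊛ c
        ≈⟨ ⊛-congˡ c (⊛-congˡ c (⊛-congʳ Z b-eq)) ⟩
      Z ⊛ (one ⊕ Z ⊛ (c ⊛ b ⊕ c ⊛ b)) ⊛ c ⊛ c
        ≈⟨ solve 3 (λ z b c → z :* (con 1 :+ z :* (c :* b :+ c :* b)) :* c :* c
                           := z :* c :* c :+ z :* (c :* (z :* b :* c :* c) :+ c :* (z :* b :* c :* c))) ≈-refl Z b c ⟩
      Z ⊛ c ⊛ c ⊕ Z ⊛ (c ⊛ (Z ⊛ b ⊛ c ⊛ c) ⊕ c ⊛ (Z ⊛ b ⊛ c ⊛ c)) ∎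

  linear-solution : ∀ {X P} → X ≈ P ⊕ Z ⊛ (c ⊛ X ⊕ c ⊛ X) → X ≈ b ⊛ P
  linear-solution {X} {P} X-eq = guarded-unique P (λ x → c ⊛ x ⊕ c ⊛ x) (double-product-causal c) X-eq bP-eq
    where
    bP-eq : b ⊛ P ≈ P ⊕ Z ⊛ (c ⊛ (b ⊛ P) ⊕ c ⊛ (b ⊛ P))
    bP-eq = begin
      b ⊛ P
        ≈⟨ ⊛-congˡ P b-eq ⟩
      (one ⊕ Z ⊛ (c ⊛ b ⊕ c ⊛ b)) ⊛ P
        ≈⟨ solve 4 (λ b c z p → (con 1 :+ z :* (c :* b :+ c :* b)) :* p
                             := p :+ z :* (c :* (b :* p) :+ c :* (b :* p))) ≈-refl b c Z P ⟩
      P ⊕ Z ⊛ (c ⊛ (b ⊛ P) ⊕ c ⊛ (b ⊛ P)) ∎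

module BinomialCoefficients (b c : Series) (isB : IsB b) (isC : IsC c) where

  open BCIdentities b c isB isC using (c-head; b-eq)

  private
    c^ : ℕ → Series
    c^ zero    = one
    c^ (suc k) = c ⊛ c^ k

    c^-head : ∀ k → c^ k 0 ≡ 1
    c^-head zero    = refl
    c^-head (suc k) = trans (⊛-head c (c^ k)) (cong₂ _*_ c-head (c^-head k))

    bc^-step : ∀ k → b ⊛ c^ (suc k) ≈ b ⊛ c^ k ⊕ Z ⊛ (b ⊛ c^ (2 + k))
    bc^-step k = ≈-trans (⊛-congʳ b (⊛-congˡ (c^ k) isC))
      (solve 4 (λ b z c w → b :* ((con 1 :+ z :* c :* c) :* w) := b :* w :+ z :* (b :* (c :* (c :* w)))) ≈-refl b Z c (c^ k))

    bc^-coeff : ∀ n k → (b ⊛ c^ k) n ≡ (2 * n + k) C n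
    bc^-coeff zero k = trans (⊛-head b (c^ k)) (cong₂ _*_ (proj₁ isB) (c^-head k))
    bc^-coeff (suc n) zero = begin
      (b ⊛ one) (suc n)
        ≡⟨ trans (⊛-comm b one (suc n)) (⊛-identityˡ b (suc n)) ⟩
      b (suc n)
        ≡⟨ b-eq (suc n) ⟩
      (Z ⊛ (c ⊛ b ⊕ c ⊛ b)) (suc n)
        ≡⟨ Z⊛-suc (c ⊛ b ⊕ c ⊛ b) n ⟩
      (c ⊛ b) n + (c ⊛ b) n
        ≡⟨ cong₂ _+_ (cb≈bc^1 n) (cb≈bc^1 n) ⟩
      (b ⊛ c^ 1) n + (b ⊛ c^ 1) n
        ≡⟨ cong₂ _+_ (bc^-coeff n 1) (bc^-coeff n 1) ⟩
      m C n + m C n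
        ≡⟨ cong (m C n +_) (trans (nCk≡nC[n∸k] n≤m) (cong (m C_) m∸n≡1+n)) ⟩
      m C n + m C suc n
        ≡⟨ nCk+nC[k+1]≡[n+1]C[k+1] m n ⟩
      suc m C suc n
        ≡⟨ cong (_C suc n) 1+m≡2[1+n]+0 ⟩
      (2 * suc n + 0) C suc n ∎
      where
      open ≡-Reasoning
      m : ℕ
      m = 2 * n + 1
      cb≈bc^1 : c ⊛ b ≈ b ⊛ c^ 1
      cb≈bc^1 = solve 2 (λ b c → c :* b := b :* (c :* con 1)) ≈-refl b c
      m≡n+[1+n] : m ≡ n + suc n
      m≡n+[1+n] = ℕ-solve 1 (λ n → conℕ 2 *ℕ n +ℕ conℕ 1 =ℕ n +ℕ (conℕ 1 +ℕ n)) refl n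
      n≤m : n ≤ m
      n≤m = subst (n ≤_) (sym m≡n+[1+n]) (m≤m+n n (suc n))
      m∸n≡1+n : m ∸ n ≡ suc n
      m∸n≡1+n = trans (cong (_∸ n) m≡n+[1+n]) (m+n∸m≡n n (suc n))
      1+m≡2[1+n]+0 : suc m ≡ 2 * suc n + 0
      1+m≡2[1+n]+0 = ℕ-solve 1 (λ n → conℕ 1 +ℕ (conℕ 2 *ℕ n +ℕ conℕ 1) =ℕ conℕ 2 *ℕ (conℕ 1 +ℕ n) +ℕ conℕ 0) refl n
    bc^-coeff (suc n) (suc k) = begin
      (b ⊛ c^ (suc k)) (suc n)
        ≡⟨ bc^-step k (suc n) ⟩
      (b ⊛ c^ k) (suc n) + (Z ⊛ (b ⊛ c^ (2 + k))) (suc n)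
        ≡⟨ cong ((b ⊛ c^ k) (suc n) +_) (Z⊛-suc (b ⊛ c^ (2 + k)) n) ⟩
      (b ⊛ c^ k) (suc n) + (b ⊛ c^ (2 + k)) n
        ≡⟨ cong₂ _+_ (bc^-coeff (suc n) k) (bc^-coeff n (2 + k)) ⟩
      (2 * suc n + k) C suc n + (2 * n + (2 + k)) C n
        ≡⟨ cong (λ t → (2 * suc n + k) C suc n + t C n) 2n+[2+k]≡2[1+n]+k ⟩
      (2 * suc n + k) C suc n + (2 * suc n + k) C n
        ≡⟨ +-comm ((2 * suc n + k) C suc n) _ ⟩
      (2 * suc n + k) C n + (2 * suc n + k) C suc n
        ≡⟨ nCk+nC[k+1]≡[n+1]C[k+1] (2 * suc n + k) n ⟩
      suc (2 * suc n + k) C suc n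
        ≡⟨ cong (_C suc n) (+-suc (2 * suc n) k) ⟨
      (2 * suc n + suc k) C suc n ∎
      where
      open ≡-Reasoning
      2n+[2+k]≡2[1+n]+k : 2 * n + (2 + k) ≡ 2 * suc n + k
      2n+[2+k]≡2[1+n]+k = ℕ-solve 2 (λ n k → conℕ 2 *ℕ n +ℕ (conℕ 2 +ℕ k) =ℕ conℕ 2 *ℕ (conℕ 1 +ℕ n) +ℕ k)
                                    refl n k

  z²bc³≡bin : ∀ n → (Z² ⊛ b ⊛ c ⊛ c ⊛ c) n ≡ bin n
  z²bc³≡bin n = trans (reassociate n) (coeff n)
    where
    reassociate : Z² ⊛ b ⊛ c ⊛ c ⊛ c ≈ Z ⊛ (Z ⊛ (b ⊛ c^ 3))
    reassociate = ≈-trans (⊛-congˡ c (⊛-congˡ c (⊛-congˡ c (⊛-congˡ b Z²≈Z⊛Z))))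
      (solve 3 (λ z b c → z :* z :* b :* c :* c :* c := z :* (z :* (b :* (c :* (c :* (c :* con 1)))))) ≈-refl Z b c)
    coeff : ∀ n → (Z ⊛ (Z ⊛ (b ⊛ c^ 3))) n ≡ bin n
    coeff zero          = refl
    coeff (suc zero)    = Z⊛-suc (Z ⊛ (b ⊛ c^ 3)) 0
    coeff (suc (suc m)) = trans (Z⊛-suc (Z ⊛ (b ⊛ c^ 3)) (suc m)) (trans (Z⊛-suc (b ⊛ c^ 3) m) (bc^-coeff m 3))

<ᵇ-true : ∀ {m n} → m < n → (m <ᵇ n) ≡ true
<ᵇ-true (s≤s z≤n)       = refl
<ᵇ-true (s≤s (s≤s m<n)) = <ᵇ-true (s≤s m<n)

<ᵇ-false : ∀ {m n} → n ≤ m → (m <ᵇ n) ≡ false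
<ᵇ-false z≤n       = refl
<ᵇ-false (s≤s n≤m) = <ᵇ-false n≤m

+-<ᵇ-+ : ∀ c m n → ((c + m) <ᵇ (c + n)) ≡ (m <ᵇ n)
+-<ᵇ-+ zero    m n = refl
+-<ᵇ-+ (suc c) m n = +-<ᵇ-+ c m n

countB-++ : ∀ p xs ys → countB p (xs ++ ys) ≡ countB p xs + countB p ys
countB-++ p xs ys = trans (cong length (filter-++ (λ y → T? (p y)) xs ys)) (length-++ (filter (λ y → T? (p y)) xs))

countB-all : ∀ p {xs} → All (λ x → T (p x)) xs → countB p xs ≡ length xs
countB-all p all = cong length (filter-all (λ y → T? (p y)) all)

countB-none : ∀ p {xs} → All (λ x → ¬ T (p x)) xs → countB p xs ≡ 0
countB-none p none = cong length (filter-none (λ y → T? (p y)) none)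

countB-map : ∀ p q f xs → (∀ x → p (f x) ≡ q x) → countB p (map f xs) ≡ countB q xs
countB-map p q f []       _  = refl
countB-map p q f (x ∷ xs) pf≡q rewrite pf≡q x with q x
... | true  = cong suc (countB-map p q f xs pf≡q)
... | false = countB-map p q f xs pf≡q

countB≡0⇒none : ∀ p xs → countB p xs ≡ 0 → All (λ x → ¬ T (p x)) xs
countB≡0⇒none p []       _ = []
countB≡0⇒none p (x ∷ xs) eq with p x in px
countB≡0⇒none p (x ∷ xs) () | true
countB≡0⇒none p (x ∷ xs) eq | false = subst T px ∷ countB≡0⇒none p xs eq

below above : ℕ → ℕ → Bool
below x z = z <ᵇ x
above x z = x <ᵇ z

countB-below-of-above : ∀ {x ys} → All (x <_) ys → countB (below x) ys ≡ 0
countB-below-of-above {x} x<ys = countB-none (below x) (All.map (λ x<y → subst T (<ᵇ-false (<⇒≤ x<y))) x<ys)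

countB-above-of-above : ∀ {x ys} → All (x <_) ys → countB (above x) ys ≡ length ys
countB-above-of-above {x} x<ys = countB-all (above x) (All.map <⇒<ᵇ x<ys)

countB-below-of-below : ∀ {x ys} → All (_< x) ys → countB (below x) ys ≡ length ys
countB-below-of-below {x} ys<x = countB-all (below x) (All.map <⇒<ᵇ ys<x)

countB-above-of-below : ∀ {x ys} → All (_< x) ys → countB (above x) ys ≡ 0
countB-above-of-below {x} ys<x = countB-none (above x) (All.map (λ y<x → subst T (<ᵇ-false (<⇒≤ y<x))) ys<x)

raise : ℕ → List ℕ → List ℕ
raise c = map (c +_)

countB-below-raise : ∀ c x ys → countB (below (c + x)) (raise c ys) ≡ countB (below x) ys
countB-below-raise c x ys = countB-map _ _ (c +_) ys (λ y → +-<ᵇ-+ c y x)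

countB-above-raise : ∀ c x ys → countB (above (c + x)) (raise c ys) ≡ countB (above x) ys
countB-above-raise c x ys = countB-map _ _ (c +_) ys (λ y → +-<ᵇ-+ c x y)

pairs31-raise : ∀ c x ys → pairs31 (c + x) (raise c ys) ≡ pairs31 x ys
pairs31-raise c x []       = refl
pairs31-raise c x (y ∷ ys) rewrite +-<ᵇ-+ c x y | countB-below-raise c x ys | pairs31-raise c x ys = refl

occ2-3-1-raise : ∀ c ys → occ2-3-1 (raise c ys) ≡ occ2-3-1 ys
occ2-3-1-raise c []       = refl
occ2-3-1-raise c (y ∷ ys) = cong₂ _+_ (pairs31-raise c y ys) (occ2-3-1-raise c ys)

occ2-1-raise : ∀ c ys → occ2-1 (raise c ys) ≡ occ2-1 ys
occ2-1-raise c []       = refl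
occ2-1-raise c (y ∷ ys) = cong₂ _+_ (countB-below-raise c y ys) (occ2-1-raise c ys)

occ1-2-raise : ∀ c ys → occ1-2 (raise c ys) ≡ occ1-2 ys
occ1-2-raise c []       = refl
occ1-2-raise c (y ∷ ys) = cong₂ _+_ (countB-above-raise c y ys) (occ1-2-raise c ys)

occ21-raise : ∀ c ys → occ21 (raise c ys) ≡ occ21 ys
occ21-raise c []           = refl
occ21-raise c (x ∷ [])     = refl
occ21-raise c (x ∷ y ∷ ys) = cong₂ _+_ (cong (if_then 1 else 0) (+-<ᵇ-+ c y x)) (occ21-raise c (y ∷ ys))

occ12-raise : ∀ c ys → occ12 (raise c ys) ≡ occ12 ys
occ12-raise c []           = refl
occ12-raise c (x ∷ [])     = refl
occ12-raise c (x ∷ y ∷ ys) = cong₂ _+_ (cong (if_then 1 else 0) (+-<ᵇ-+ c x y)) (occ12-raise c (y ∷ ys))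

infix 4 _≺_
_≺_ : List ℕ → List ℕ → Set
xs ≺ ys = All (λ x → All (x <_) ys) xs

sign : ℕ → ℕ
sign zero    = 0
sign (suc _) = 1

pairs31-of-above : ∀ {x} ys → All (x <_) ys → pairs31 x ys ≡ 0
pairs31-of-above []       []               = refl
pairs31-of-above (y ∷ ys) (x<y ∷ x<ys) rewrite <ᵇ-true x<y | countB-below-of-above x<ys = pairs31-of-above ys x<ys

pairs31-++-above : ∀ {x} xs {ys} → All (x <_) ys → pairs31 x (xs ++ ys) ≡ pairs31 x xs
pairs31-++-above         []       x<ys = pairs31-of-above _ x<ys
pairs31-++-above {x} (y ∷ xs) {ys} x<ys
  rewrite pairs31-++-above xs x<ys | countB-++ (below x) xs ys | countB-below-of-above x<ys
        | +-identityʳ (countB (below x) xs) = refl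

pairs31-++-below : ∀ {x} xs {ys} → All (_< x) xs → pairs31 x (xs ++ ys) ≡ pairs31 x ys
pairs31-++-below []       []           = refl
pairs31-++-below (y ∷ xs) (y<x ∷ xs<x) rewrite <ᵇ-false (<⇒≤ y<x) = pairs31-++-below xs xs<x

occ2-3-1-++ : ∀ xs {ys} → xs ≺ ys → occ2-3-1 (xs ++ ys) ≡ occ2-3-1 xs + occ2-3-1 ys
occ2-3-1-++ []       []             = refl
occ2-3-1-++ (x ∷ xs) (x<ys ∷ xs≺ys) rewrite pairs31-++-above xs x<ys | occ2-3-1-++ xs xs≺ys =
  sym (+-assoc (pairs31 x xs) _ _)

occ2-1-++ : ∀ xs {ys} → xs ≺ ys → occ2-1 (xs ++ ys) ≡ occ2-1 xs + occ2-1 ys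
occ2-1-++ []       []             = refl
occ2-1-++ (x ∷ xs) {ys} (x<ys ∷ xs≺ys)
  rewrite countB-++ (below x) xs ys | countB-below-of-above x<ys | occ2-1-++ xs xs≺ys
        | +-identityʳ (countB (below x) xs) = sym (+-assoc (countB (below x) xs) _ _)

occ1-2-++ : ∀ xs {ys} → xs ≺ ys → occ1-2 (xs ++ ys) ≡ occ1-2 xs + occ1-2 ys + length xs * length ys
occ1-2-++ []       []             = sym (+-identityʳ _)
occ1-2-++ (x ∷ xs) {ys} (x<ys ∷ xs≺ys)
  rewrite countB-++ (above x) xs ys | countB-above-of-above x<ys | occ1-2-++ xs xs≺ys =
  ℕ-solve 5 (λ a l o o′ p → a +ℕ l +ℕ (o +ℕ o′ +ℕ p) =ℕ a +ℕ o +ℕ o′ +ℕ (l +ℕ p)) refl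
    (countB (above x) xs) (length ys) (occ1-2 xs) (occ1-2 ys) (length xs * length ys)

occ21-++ : ∀ xs {ys} → xs ≺ ys → occ21 (xs ++ ys) ≡ occ21 xs + occ21 ys
occ21-++ []           []                      = refl
occ21-++ (x ∷ [])     {[]}     _              = refl
occ21-++ (x ∷ [])     {y ∷ ys} ((x<y ∷ _) ∷ _) rewrite <ᵇ-false (<⇒≤ x<y) = refl
occ21-++ (x ∷ x′ ∷ xs) (_ ∷ xs≺ys) rewrite occ21-++ (x′ ∷ xs) xs≺ys =
  sym (+-assoc (if x′ <ᵇ x then 1 else 0) _ _)

occ12-++ : ∀ xs {ys} → xs ≺ ys → occ12 (xs ++ ys) ≡ occ12 xs + occ12 ys + sign (length xs) * sign (length ys)
occ12-++ []           []                      = sym (+-identityʳ _)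
occ12-++ (x ∷ [])     {[]}     _              = refl
occ12-++ (x ∷ [])     {y ∷ ys} ((x<y ∷ _) ∷ _) rewrite <ᵇ-true x<y = +-comm 1 (occ12 (y ∷ ys))
occ12-++ (x ∷ x′ ∷ xs) {ys} (_ ∷ xs≺ys) rewrite occ12-++ (x′ ∷ xs) xs≺ys =
  ℕ-solve 4 (λ a o o′ s → a +ℕ (o +ℕ o′ +ℕ (s +ℕ conℕ 0)) =ℕ a +ℕ o +ℕ o′ +ℕ (s +ℕ conℕ 0)) refl
    (if x <ᵇ x′ then 1 else 0) (occ12 (x′ ∷ xs)) (occ12 ys) (sign (length ys))

occ21-∷ : ∀ x zs → occ21 (x ∷ zs) ≡ first21 (x ∷ zs) + occ21 zs
occ21-∷ x []      = refl
occ21-∷ x (_ ∷ _) = refl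

occ12-∷ : ∀ x zs → occ12 (x ∷ zs) ≡ first12 (x ∷ zs) + occ12 zs
occ12-∷ x []      = refl
occ12-∷ x (_ ∷ _) = refl

first21-separated : ∀ {x} xs ys → All (_< x) xs → All (x <_) ys → first21 (x ∷ xs ++ ys) ≡ sign (length xs)
first21-separated (_ ∷ _) _       (y<x ∷ _) _         rewrite <ᵇ-true y<x           = refl
first21-separated []      []      _         _         = refl
first21-separated []      (_ ∷ _) _         (x<y ∷ _) rewrite <ᵇ-false (<⇒≤ x<y) = refl

first12-separated : ∀ {x} xs ys → All (_< x) xs → All (x <_) ys →
                    first12 (x ∷ xs ++ ys) ≡ (1 ∸ sign (length xs)) * sign (length ys)
first12-separated (_ ∷ _) _       (y<x ∷ _) _         rewrite <ᵇ-false (<⇒≤ y<x) = refl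
first12-separated []      []      _         _         = refl
first12-separated []      (_ ∷ _) _         (x<y ∷ _) rewrite <ᵇ-true x<y           = refl

-- An entry z < x after an entry y > x would give the occurrence x y z of 2-3-1.
pairs31≡0⇒above : ∀ {x} ys → Maybe.All (λ y → ¬ y < x) (head ys) → All (x ≢_) ys →
                   pairs31 x ys ≡ 0 → All (x <_) ys
pairs31≡0⇒above []       _           _            _  = []
pairs31≡0⇒above {x} (y ∷ ys) (just y≮x) (x≢y ∷ x≢ys) p≡0 =
  x<y ∷ All.zipWith later (countB≡0⇒none (below x) ys below≡0 , x≢ys)
  where
  x<y : x < y
  x<y = ≤∧≢⇒< (≮⇒≥ y≮x) x≢y
  below≡0 : countB (below x) ys ≡ 0
  below≡0 = m+n≡0⇒m≡0 _ (subst (λ b → (if b then countB (below x) ys else 0) + pairs31 x ys ≡ 0) (<ᵇ-true x<y) p≡0)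
  later : ∀ {z} → ¬ T (z <ᵇ x) × x ≢ z → x < z
  later (z≮ᵇx , x≢z) = ≤∧≢⇒< (≮⇒≥ (λ z<x → z≮ᵇx (<⇒<ᵇ z<x))) x≢z

++-injectiveˡ : ∀ {A : Set} (xs xs′ : List A) {ys ys′} →
                length xs ≡ length xs′ → xs ++ ys ≡ xs′ ++ ys′ → xs ≡ xs′
++-injectiveˡ []       []         _   _ = refl
++-injectiveˡ (x ∷ xs) (x′ ∷ xs′) len e =
  cong₂ _∷_ (∷-injectiveˡ e) (++-injectiveˡ xs xs′ (suc-injective len) (∷-injectiveʳ e))

Unique-++⁻ : ∀ {A : Set} (xs : List A) {ys} → Unique (xs ++ ys) → Unique xs × Unique ys
Unique-++⁻ []       u           = [] , u
Unique-++⁻ (x ∷ xs) (x∉ ∷ u) with Unique-++⁻ xs u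
... | uxs , uys = All.++⁻ˡ xs x∉ ∷ uxs , uys

concatMap-unique : ∀ {A B : Set} (f : A → List B) {xs} → Unique xs →
                   (∀ {x} → x ∈ xs → Unique (f x)) →
                   (∀ {x y z} → x ∈ xs → y ∈ xs → z ∈ f x → z ∈ f y → x ≡ y) →
                   Unique (concatMap f xs)
concatMap-unique f {[]}     _          _      _        = []
concatMap-unique f {x ∷ xs} (x∉ ∷ uxs) unique disjoint = Unique.++⁺ (unique (here refl))
  (concatMap-unique f uxs (λ x∈ → unique (there x∈)) (λ x∈ y∈ → disjoint (there x∈) (there y∈)))
  (λ (z∈fx , z∈rest) → let (y , y∈xs , z∈fy) = find (∈-concatMap⁻ f {xs = xs} z∈rest)
                       in All.lookup x∉ y∈xs (disjoint (here refl) (there y∈xs) z∈fx z∈fy))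

unique-⊆-length : ∀ {xs ys : List ℕ} → Unique xs → Unique ys → All (_∈ ys) xs → length xs ≤ length ys
unique-⊆-length {xs} {ys} uxs uys xs⊆ys = begin
  length xs
    ≡⟨ ↭.↭-length (∼bag⇒↭ (unique∧set⇒bag uxs (Unique.filter⁺ (_∈? xs) uys) (mk⇔ to from))) ⟩
  length (filter (_∈? xs) ys)
    ≤⟨ length-filter (_∈? xs) ys ⟩
  length ys ∎
  where
  open ≤-Reasoning
  to : ∀ {v} → v ∈ xs → v ∈ filter (_∈? xs) ys
  to v∈xs = ∈-filter⁺ (_∈? xs) (All.lookup xs⊆ys v∈xs) v∈xs
  from : ∀ {v} → v ∈ filter (_∈? xs) ys → v ∈ xs
  from v∈ = proj₂ (∈-filter⁻ (_∈? xs) {xs = ys} v∈)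

freshᵇ⇒fresh : ∀ x xs → T (not (any (λ y → x ≡ᵇ y) xs)) → All (x ≢_) xs
freshᵇ⇒fresh x []       _ = []
freshᵇ⇒fresh x (y ∷ ys) t with x ≡ᵇ y in eq
... | false = (λ x≡y → subst T eq (≡⇒≡ᵇ x y x≡y)) ∷ freshᵇ⇒fresh x ys t

fresh⇒freshᵇ : ∀ x xs → All (x ≢_) xs → T (not (any (λ y → x ≡ᵇ y) xs))
fresh⇒freshᵇ x []       []           = tt
fresh⇒freshᵇ x (y ∷ ys) (x≢y ∷ x∉ys) with x ≡ᵇ y in eq
... | true  = x≢y (≡ᵇ⇒≡ x y (subst T (sym eq) tt))
... | false = fresh⇒freshᵇ x ys x∉ys

distinct⇒Unique : ∀ w → T (distinct w) → Unique w
distinct⇒Unique []       _ = []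
distinct⇒Unique (x ∷ xs) t with Equivalence.to T-∧ t
... | fresh , rest = freshᵇ⇒fresh x xs fresh ∷ distinct⇒Unique xs rest

Unique⇒distinct : ∀ w → Unique w → T (distinct w)
Unique⇒distinct []       []         = tt
Unique⇒distinct (x ∷ xs) (x∉ ∷ uxs) = Equivalence.from T-∧ (fresh⇒freshᵇ x xs x∉ , Unique⇒distinct xs uxs)

range : ℕ → List ℕ
range n = applyUpTo suc n

range-unique : ∀ n → Unique (range n)
range-unique n = Unique.applyUpTo⁺₁ suc n (λ i<j _ e → <⇒≢ i<j (suc-injective e))

∈-range⁻ : ∀ {n v} → v ∈ range n → 0 < v × v ≤ n
∈-range⁻ v∈ with ∈-applyUpTo⁻ suc v∈
... | i , i<n , refl = s≤s z≤n , i<n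

∈-range⁺ : ∀ {n v} → 0 < v → v ≤ n → v ∈ range n
∈-range⁺ {v = suc i} _ v≤n = ∈-applyUpTo⁺ suc v≤n

record IsPerm (n : ℕ) (w : List ℕ) : Set where
  field
    unique  : Unique w
    inRange : All (_∈ range n) w
    length≡ : length w ≡ n

∈-words⁻ : ∀ k n {w} → w ∈ words k n → length w ≡ k × All (_∈ range n) w
∈-words⁻ zero    n (here refl) = refl , []
∈-words⁻ (suc k) n w∈ with find (∈-concatMap⁻ (λ w → map (_∷ w) (range n)) {xs = words k n} w∈)
... | w′ , w′∈ , a∷w′∈ with ∈-map⁻ (_∷ w′) a∷w′∈
... | a , a∈ , refl with ∈-words⁻ k n w′∈
... | length≡ , inRange = cong suc length≡ , a∈ ∷ inRange

∈-words⁺ : ∀ k n {w} → length w ≡ k → All (_∈ range n) w → w ∈ words k n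
∈-words⁺ zero    n {[]}    refl []              = here refl
∈-words⁺ (suc k) n {a ∷ w} eq   (a∈ ∷ inRange) = ∈-concatMap⁺ (λ w → map (_∷ w) (range n)) {xs = words k n}
  (lose (∈-words⁺ k n (suc-injective eq) inRange) (∈-map⁺ (_∷ w) a∈))

words-unique : ∀ k n → Unique (words k n)
words-unique zero    n = [] ∷ []
words-unique (suc k) n = concatMap-unique (λ w → map (_∷ w) (range n)) (words-unique k n)
  (λ _ → Unique.map⁺ ∷-injectiveˡ (range-unique n)) same-tail
  where
  same-tail : ∀ {x y z} → x ∈ words k n → y ∈ words k n →
              z ∈ map (_∷ x) (range n) → z ∈ map (_∷ y) (range n) → x ≡ y
  same-tail {x} {y} _ _ z∈x z∈y with ∈-map⁻ (_∷ x) z∈x | ∈-map⁻ (_∷ y) z∈y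
  ... | _ , _ , refl | _ , _ , e = ∷-injectiveʳ e

∈-Perm⁻ : ∀ {n w} → w ∈ Perm n → IsPerm n w
∈-Perm⁻ {n} {w} w∈ with ∈-filter⁻ (λ w → T? (distinct w)) {xs = words n n} w∈
... | w∈words , dist with ∈-words⁻ n n w∈words
... | length≡ , inRange = record { unique = distinct⇒Unique w dist ; inRange = inRange ; length≡ = length≡ }

∈-Perm⁺ : ∀ {n w} → IsPerm n w → w ∈ Perm n
∈-Perm⁺ {n} {w} p = ∈-filter⁺ (λ w → T? (distinct w))
  (∈-words⁺ n n (IsPerm.length≡ p) (IsPerm.inRange p)) (Unique⇒distinct w (IsPerm.unique p))

∈-Av231⁻ : ∀ {n w} → w ∈ Av231 n → IsPerm n w × occ2-3-1 w ≡ 0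
∈-Av231⁻ {n} w∈ with ∈-filter⁻ (λ w → T? (occ2-3-1 w ≡ᵇ 0)) {xs = Perm n} w∈
... | w∈Perm , avoids = ∈-Perm⁻ w∈Perm , ≡ᵇ⇒≡ _ 0 avoids

∈-Av231⁺ : ∀ {n w} → IsPerm n w → occ2-3-1 w ≡ 0 → w ∈ Av231 n
∈-Av231⁺ p avoids = ∈-filter⁺ (λ w → T? (occ2-3-1 w ≡ᵇ 0)) (∈-Perm⁺ p) (≡⇒≡ᵇ _ 0 avoids)

Av231-unique : ∀ n → Unique (Av231 n)
Av231-unique n = Unique.filter⁺ (λ w → T? (occ2-3-1 w ≡ᵇ 0)) (Unique.filter⁺ (λ w → T? (distinct w)) (words-unique n n))

unique-range-length : ∀ {n xs} → Unique xs → All (_∈ range n) xs → length xs ≤ n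
unique-range-length {n} uxs inRange = subst (_ ≤_) (length-applyUpTo suc n) (unique-⊆-length uxs (range-unique n) inRange)

-- Decomposition of 231-avoiding permutations

assemble : ℕ → List ℕ → List ℕ → List ℕ
assemble k α β = suc k ∷ α ++ raise (suc k) β

module _ {k m α β} (α-perm : IsPerm k α) (β-perm : IsPerm m β) where

  private
    γ : List ℕ
    γ = raise (suc k) β

    α-below : All (_< suc k) α
    α-below = All.map (λ v∈ → s≤s (proj₂ (∈-range⁻ v∈))) (IsPerm.inRange α-perm)

    γ-above : All (suc k <_) γ
    γ-above = All.map⁺ (All.map (λ v∈ → m<m+n (suc k) (proj₁ (∈-range⁻ v∈))) (IsPerm.inRange β-perm))

    α≺γ : α ≺ γ
    α≺γ = All.map (λ a<k+1 → All.map (<-trans a<k+1) γ-above) α-below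

    length-γ : length γ ≡ m
    length-γ = trans (length-map (suc k +_) β) (IsPerm.length≡ β-perm)

  assemble-perm : IsPerm (suc (k + m)) (assemble k α β)
  assemble-perm = record { unique = unique ; inRange = inRange ; length≡ = length≡ }
    where
    unique : Unique (assemble k α β)
    unique = All.++⁺ (All.map (λ a<k+1 k+1≡a → <-irrefl (sym k+1≡a) a<k+1) α-below)
                     (All.map (λ k+1<g k+1≡g → <-irrefl k+1≡g k+1<g) γ-above)
           ∷ Unique.++⁺ (IsPerm.unique α-perm) (Unique.map⁺ (+-cancelˡ-≡ (suc k) _ _) (IsPerm.unique β-perm))
                        (λ (v∈α , v∈γ) → <-irrefl refl (All.lookup (All.lookup α≺γ v∈α) v∈γ))
    inRange : All (_∈ range (suc (k + m))) (assemble k α β)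
    inRange = ∈-range⁺ (s≤s z≤n) (s≤s (m≤m+n k m))
            ∷ All.++⁺ (All.map α-entry (IsPerm.inRange α-perm)) (All.map⁺ (All.map γ-entry (IsPerm.inRange β-perm)))
      where
      α-entry : ∀ {v} → v ∈ range k → v ∈ range (suc (k + m))
      α-entry v∈ = ∈-range⁺ (proj₁ (∈-range⁻ v∈)) (m≤n⇒m≤1+n (≤-trans (proj₂ (∈-range⁻ v∈)) (m≤m+n k m)))
      γ-entry : ∀ {v} → v ∈ range m → suc k + v ∈ range (suc (k + m))
      γ-entry v∈ = ∈-range⁺ (s≤s z≤n) (s≤s (+-monoʳ-≤ k (proj₂ (∈-range⁻ v∈))))
    length≡ : length (assemble k α β) ≡ suc (k + m)
    length≡ = cong suc (trans (length-++ α) (cong₂ _+_ (IsPerm.length≡ α-perm) length-γ))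

  assemble-occ2-3-1 : occ2-3-1 (assemble k α β) ≡ occ2-3-1 α + occ2-3-1 β
  assemble-occ2-3-1 = cong₂ _+_
    (trans (pairs31-++-below α α-below) (pairs31-of-above γ γ-above))
    (trans (occ2-3-1-++ α α≺γ) (cong (occ2-3-1 α +_) (occ2-3-1-raise (suc k) β)))

  assemble-first2-1 : first2-1 (assemble k α β) ≡ k
  assemble-first2-1 = begin
    countB (below (suc k)) (α ++ γ)
      ≡⟨ countB-++ (below (suc k)) α γ ⟩
    countB (below (suc k)) α + countB (below (suc k)) γ
      ≡⟨ cong₂ _+_ (countB-below-of-below α-below) (countB-below-of-above γ-above) ⟩
    length α + 0
      ≡⟨ trans (+-identityʳ _) (IsPerm.length≡ α-perm) ⟩
    k ∎
    where open ≡-Reasoning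

  assemble-first1-2 : first1-2 (assemble k α β) ≡ m
  assemble-first1-2 = begin
    countB (above (suc k)) (α ++ γ)
      ≡⟨ countB-++ (above (suc k)) α γ ⟩
    countB (above (suc k)) α + countB (above (suc k)) γ
      ≡⟨ cong₂ _+_ (countB-above-of-below α-below) (countB-above-of-above γ-above) ⟩
    length γ
      ≡⟨ length-γ ⟩
    m ∎
    where open ≡-Reasoning

  assemble-occ2-1 : occ2-1 (assemble k α β) ≡ k + occ2-1 α + occ2-1 β
  assemble-occ2-1 = trans
    (cong₂ _+_ assemble-first2-1 (trans (occ2-1-++ α α≺γ) (cong (occ2-1 α +_) (occ2-1-raise (suc k) β))))
    (sym (+-assoc k _ _))

  assemble-occ1-2 : occ1-2 (assemble k α β) ≡ suc k * m + occ1-2 α + occ1-2 β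
  assemble-occ1-2 = begin
    first1-2 (assemble k α β) + occ1-2 (α ++ γ)
      ≡⟨ cong₂ _+_ assemble-first1-2 (occ1-2-++ α α≺γ) ⟩
    m + (occ1-2 α + occ1-2 γ + length α * length γ)
      ≡⟨ cong₂ (λ o l → m + (occ1-2 α + o + l)) (occ1-2-raise (suc k) β) (cong₂ _*_ (IsPerm.length≡ α-perm) length-γ) ⟩
    m + (occ1-2 α + occ1-2 β + k * m)
      ≡⟨ ℕ-solve 4 (λ m a b k → m +ℕ (a +ℕ b +ℕ k *ℕ m) =ℕ (conℕ 1 +ℕ k) *ℕ m +ℕ a +ℕ b)
                   refl m (occ1-2 α) (occ1-2 β) k ⟩
    suc k * m + occ1-2 α + occ1-2 β ∎
    where open ≡-Reasoning

  assemble-first21 : first21 (assemble k α β) ≡ sign k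
  assemble-first21 = trans (first21-separated α γ α-below γ-above) (cong sign (IsPerm.length≡ α-perm))

  assemble-first12 : first12 (assemble k α β) ≡ (1 ∸ sign k) * sign m
  assemble-first12 = trans (first12-separated α γ α-below γ-above)
    (cong₂ (λ a g → (1 ∸ sign a) * sign g) (IsPerm.length≡ α-perm) length-γ)

  assemble-occ21 : occ21 (assemble k α β) ≡ sign k + occ21 α + occ21 β
  assemble-occ21 = begin
    occ21 (assemble k α β)                       ≡⟨ occ21-∷ (suc k) (α ++ γ) ⟩
    first21 (assemble k α β) + occ21 (α ++ γ)    ≡⟨ cong₂ _+_ assemble-first21 (occ21-++ α α≺γ) ⟩
    sign k + (occ21 α + occ21 γ)                 ≡⟨ cong (λ t → sign k + (occ21 α + t)) (occ21-raise (suc k) β) ⟩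
    sign k + (occ21 α + occ21 β)                 ≡⟨ +-assoc (sign k) _ _ ⟨
    sign k + occ21 α + occ21 β                   ∎
    where open ≡-Reasoning

  assemble-occ12 : occ12 (assemble k α β) ≡ sign m + occ12 α + occ12 β
  assemble-occ12 = begin
    occ12 (assemble k α β)
      ≡⟨ occ12-∷ (suc k) (α ++ γ) ⟩
    first12 (assemble k α β) + occ12 (α ++ γ)
      ≡⟨ cong₂ _+_ assemble-first12 (occ12-++ α α≺γ) ⟩
    (1 ∸ sign k) * sign m + (occ12 α + occ12 γ + sign (length α) * sign (length γ))
      ≡⟨ cong₂ (λ o s → (1 ∸ sign k) * sign m + (occ12 α + o + s)) (occ12-raise (suc k) β)
               (cong₂ (λ a g → sign a * sign g) (IsPerm.length≡ α-perm) length-γ) ⟩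
    (1 ∸ sign k) * sign m + (occ12 α + occ12 β + sign k * sign m)
      ≡⟨ first-or-later k (sign m) (occ12 α) (occ12 β) ⟩
    sign m + occ12 α + occ12 β ∎
    where
    open ≡-Reasoning
    -- for m > 0 there is one more ascent: right after the first entry if k = 0, after α otherwise
    first-or-later : ∀ k s a b → (1 ∸ sign k) * s + (a + b + sign k * s) ≡ s + a + b
    first-or-later zero    s a b =
      ℕ-solve 3 (λ s a b → conℕ 1 *ℕ s +ℕ (a +ℕ b +ℕ conℕ 0 *ℕ s) =ℕ s +ℕ a +ℕ b) refl s a b
    first-or-later (suc k) s a b =
      ℕ-solve 3 (λ s a b → conℕ 0 *ℕ s +ℕ (a +ℕ b +ℕ conℕ 1 *ℕ s) =ℕ s +ℕ a +ℕ b) refl s a b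

assemble-∈ : ∀ {k m α β} → α ∈ Av231 k → β ∈ Av231 m → assemble k α β ∈ Av231 (suc (k + m))
assemble-∈ α∈ β∈ with ∈-Av231⁻ α∈ | ∈-Av231⁻ β∈
... | α-perm , α-avoids | β-perm , β-avoids = ∈-Av231⁺ (assemble-perm α-perm β-perm)
  (trans (assemble-occ2-3-1 α-perm β-perm) (cong₂ _+_ α-avoids β-avoids))

record Decomposition (n : ℕ) (w : List ℕ) : Set where
  constructor decomposition
  field
    k   : ℕ
    k≤n : k ≤ n
    α β : List ℕ
    α∈  : α ∈ Av231 k
    β∈  : β ∈ Av231 (n ∸ k)
    w≡  : w ≡ assemble k α β

tight-summands : ∀ {a b k n} → k ≤ n → a ≤ k → b ≤ n ∸ k → a + b ≡ n → a ≡ k × b ≡ n ∸ k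
tight-summands {a} {b} {k} {n} k≤n a≤k b≤n∸k a+b≡n =
  a≡k , +-cancelˡ-≡ k b (n ∸ k) (trans (cong (_+ b) (sym a≡k)) (trans a+b≡n (sym (m+[n∸m]≡n k≤n))))
  where
  k≤a : k ≤ a
  k≤a = begin
    k                 ≡⟨ m∸[m∸n]≡n k≤n ⟨
    n ∸ (n ∸ k)       ≤⟨ ∸-monoˡ-≤ (n ∸ k) (≤-trans (≤-reflexive (sym a+b≡n)) (+-monoʳ-≤ a b≤n∸k)) ⟩
    a + (n ∸ k) ∸ (n ∸ k) ≡⟨ m+n∸n≡m a (n ∸ k) ⟩
    a                 ∎
    where open ≤-Reasoning
  a≡k : a ≡ k
  a≡k = ≤-antisym a≤k k≤a

-- α is the longest prefix of rest below x; avoiding 2-3-1 forces everything after it above x.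
module _ {n k rest} (w-perm : IsPerm (suc n) (suc k ∷ rest)) (w-avoids : occ2-3-1 (suc k ∷ rest) ≡ 0) where

  private
    x : ℕ
    x = suc k

    α γ β : List ℕ
    α = takeWhile (_<? x) rest
    γ = dropWhile (_<? x) rest
    β = map (_∸ x) γ

    α++γ≡rest : α ++ γ ≡ rest
    α++γ≡rest = takeWhile++dropWhile (_<? x) rest

    on-α++γ : ∀ {P : List ℕ → Set} → P rest → P (α ++ γ)
    on-α++γ {P} = subst P (sym α++γ≡rest)

    head-fresh : All (x ≢_) rest × Unique rest
    head-fresh with IsPerm.unique w-perm
    ... | x∉ ∷ u = x∉ , u

    x∉rest : All (x ≢_) rest
    x∉rest = proj₁ head-fresh

    rest-unique : Unique rest
    rest-unique = proj₂ head-fresh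

    α-below : All (_< x) α
    α-below = All.all-takeWhile (_<? x) rest

    γ-above : All (x <_) γ
    γ-above = pairs31≡0⇒above γ (All.all-head-dropWhile (_<? x) rest) (All.++⁻ʳ α (on-α++γ {All (x ≢_)} x∉rest))
      (trans (sym (pairs31-++-below α α-below)) (on-α++γ {λ zs → pairs31 x zs ≡ 0} (m+n≡0⇒m≡0 _ w-avoids)))

    α≺γ : α ≺ γ
    α≺γ = All.map (λ a<x → All.map (<-trans a<x) γ-above) α-below

    α+γ-avoid : occ2-3-1 α + occ2-3-1 γ ≡ 0
    α+γ-avoid = trans (sym (occ2-3-1-++ α α≺γ))
                      (on-α++γ {λ zs → occ2-3-1 zs ≡ 0} (m+n≡0⇒n≡0 (pairs31 x rest) w-avoids))

    raise-β : raise x β ≡ γ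
    raise-β = trans (sym (map-∘ {g = x +_} {f = _∸ x} γ))
                    (map-id-local (All.map (λ x<g → m+[n∸m]≡n (<⇒≤ x<g)) γ-above))

    α-unique : Unique α
    α-unique = proj₁ (Unique-++⁻ α (on-α++γ {Unique} rest-unique))

    β-unique : Unique β
    β-unique = Unique.map⁻ (subst Unique (sym raise-β) (proj₂ (Unique-++⁻ α (on-α++γ {Unique} rest-unique))))

    head-in-range : x ∈ range (suc n) × All (_∈ range (suc n)) rest
    head-in-range with IsPerm.inRange w-perm
    ... | x∈ ∷ r = x∈ , r

    k≤n : k ≤ n
    k≤n = ≤-pred (proj₂ (∈-range⁻ (proj₁ head-in-range)))

    rest-inRange : All (_∈ range (suc n)) (α ++ γ)
    rest-inRange = on-α++γ {All (_∈ range (suc n))} (proj₂ head-in-range)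

    α-inRange : All (_∈ range k) α
    α-inRange = All.zipWith (λ (a∈ , a<x) → ∈-range⁺ (proj₁ (∈-range⁻ a∈)) (≤-pred a<x))
                            (All.++⁻ˡ α rest-inRange , α-below)

    β-inRange : All (_∈ range (n ∸ k)) β
    β-inRange = All.map⁺ (All.zipWith (λ (g∈ , x<g) → ∈-range⁺ (m<n⇒0<n∸m x<g) (∸-monoˡ-≤ x (proj₂ (∈-range⁻ g∈))))
                                      (All.++⁻ʳ α rest-inRange , γ-above))

    length-α+β : length α + length β ≡ n
    length-α+β = begin
      length α + length β  ≡⟨ cong (length α +_) (length-map (_∸ x) γ) ⟩
      length α + length γ  ≡⟨ length-++ α ⟨
      length (α ++ γ)      ≡⟨ cong length α++γ≡rest ⟩
      length rest          ≡⟨ suc-injective (IsPerm.length≡ w-perm) ⟩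
      n                    ∎
      where open ≡-Reasoning

    lengths : length α ≡ k × length β ≡ n ∸ k
    lengths = tight-summands k≤n (unique-range-length α-unique α-inRange) (unique-range-length β-unique β-inRange) length-α+β

  decompose-with-head : Decomposition n (suc k ∷ rest)
  decompose-with-head = decomposition k k≤n α β
    (∈-Av231⁺ (record { unique = α-unique ; inRange = α-inRange ; length≡ = proj₁ lengths }) (m+n≡0⇒m≡0 _ α+γ-avoid))
    (∈-Av231⁺ (record { unique = β-unique ; inRange = β-inRange ; length≡ = proj₂ lengths })
              (trans (sym (occ2-3-1-raise x β)) (trans (cong occ2-3-1 raise-β) (m+n≡0⇒n≡0 _ α+γ-avoid))))
    (cong (x ∷_) (trans (sym α++γ≡rest) (cong (α ++_) (sym raise-β))))

decompose : ∀ {n w} → w ∈ Av231 (suc n) → Decomposition n w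
decompose {n} {[]}           w∈ = ⊥-elim (0≢1+n (IsPerm.length≡ (proj₁ (∈-Av231⁻ {suc n} w∈))))
decompose {n} {zero ∷ rest}  w∈ with IsPerm.inRange (proj₁ (∈-Av231⁻ {suc n} w∈))
... | 0∈ ∷ _ with () ← proj₁ (∈-range⁻ 0∈)
decompose {n} {suc k ∷ rest} w∈ = decompose-with-head (proj₁ (∈-Av231⁻ {suc n} w∈)) (proj₂ (∈-Av231⁻ {suc n} w∈))

assembledFrom : ℕ → ℕ → List (List ℕ)
assembledFrom n k = concatMap (λ α → map (assemble k α) (Av231 (n ∸ k))) (Av231 k)

assembled : ℕ → List (List ℕ)
assembled n = concatMap (assembledFrom n) (upTo (suc n))

∈-assembled⁻ : ∀ {n w} → w ∈ assembled n →
               ∃[ k ] k < suc n × ∃[ α ] α ∈ Av231 k × ∃[ β ] β ∈ Av231 (n ∸ k) × w ≡ assemble k α β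
∈-assembled⁻ {n} w∈ with find (∈-concatMap⁻ (assembledFrom n) {xs = upTo (suc n)} w∈)
... | k , k∈ , w∈k with find (∈-concatMap⁻ (λ α → map (assemble k α) (Av231 (n ∸ k))) {xs = Av231 k} w∈k)
... | α , α∈ , w∈α with ∈-map⁻ (assemble k α) w∈α
... | β , β∈ , w≡ = k , ∈-upTo⁻ k∈ , α , α∈ , β , β∈ , w≡

∈-assembled⁺ : ∀ {n k α β} → k < suc n → α ∈ Av231 k → β ∈ Av231 (n ∸ k) → assemble k α β ∈ assembled n
∈-assembled⁺ {n} {k} {α} k<1+n α∈ β∈ = ∈-concatMap⁺ (assembledFrom n) {xs = upTo (suc n)} (lose (∈-upTo⁺ k<1+n)
  (∈-concatMap⁺ (λ α → map (assemble k α) (Av231 (n ∸ k))) {xs = Av231 k} (lose α∈ (∈-map⁺ (assemble k α) β∈))))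

assembled-unique : ∀ n → Unique (assembled n)
assembled-unique n = concatMap-unique (assembledFrom n) (Unique.upTo⁺ (suc n)) (λ {k} _ → from-unique k) same-head
  where
  same-α : ∀ {k α α′ w} → α ∈ Av231 k → α′ ∈ Av231 k → w ∈ map (assemble k α) (Av231 (n ∸ k)) →
           w ∈ map (assemble k α′) (Av231 (n ∸ k)) → α ≡ α′
  same-α {k} {α} {α′} α∈ α′∈ w∈ w∈′ with ∈-map⁻ (assemble k α) w∈ | ∈-map⁻ (assemble k α′) w∈′
  ... | β , _ , refl | β′ , _ , e = ++-injectiveˡ α α′ (trans (length≡ α∈) (sym (length≡ α′∈))) (∷-injectiveʳ e)
    where
    length≡ : ∀ {α} → α ∈ Av231 k → length α ≡ k
    length≡ α∈ = IsPerm.length≡ (proj₁ (∈-Av231⁻ {k} α∈))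
  from-unique : ∀ k → Unique (assembledFrom n k)
  from-unique k = concatMap-unique (λ α → map (assemble k α) (Av231 (n ∸ k))) (Av231-unique k)
    (λ _ → Unique.map⁺ (λ e → map-injective (+-cancelˡ-≡ (suc k) _ _) (++-cancelˡ _ _ _ (∷-injectiveʳ e)))
                       (Av231-unique (n ∸ k)))
    same-α
  head-of : ∀ {k w} → w ∈ assembledFrom n k → ∃[ t ] w ≡ suc k ∷ t
  head-of {k} w∈ with find (∈-concatMap⁻ (λ α → map (assemble k α) (Av231 (n ∸ k))) {xs = Av231 k} w∈)
  ... | α , _ , w∈α with ∈-map⁻ (assemble k α) w∈α
  ... | _ , _ , refl = _ , refl
  same-head : ∀ {k k′ w} → k ∈ upTo (suc n) → k′ ∈ upTo (suc n) →
              w ∈ assembledFrom n k → w ∈ assembledFrom n k′ → k ≡ k′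
  same-head {k} {k′} _ _ w∈ w∈′ with head-of {k} w∈ | head-of {k′} w∈′
  ... | _ , refl | _ , e = suc-injective (∷-injectiveˡ e)

Av231-suc↭assembled : ∀ n → Av231 (suc n) ↭ assembled n
Av231-suc↭assembled n = ∼bag⇒↭ (unique∧set⇒bag (Av231-unique (suc n)) (assembled-unique n) (mk⇔ to from))
  where
  to : ∀ {w} → w ∈ Av231 (suc n) → w ∈ assembled n
  to w∈ with decompose {n} w∈
  ... | decomposition k k≤n α β α∈ β∈ refl = ∈-assembled⁺ (s≤s k≤n) α∈ β∈
  from : ∀ {w} → w ∈ assembled n → w ∈ Av231 (suc n)
  from w∈ with ∈-assembled⁻ {n} w∈
  ... | k , k<1+n , α , α∈ , β , β∈ , refl =
    subst (λ l → assemble k α β ∈ Av231 (suc l)) (m+[n∸m]≡n (≤-pred k<1+n)) (assemble-∈ α∈ β∈)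

module _ {A : Set} where

  sum-map-+ : ∀ (f g : A → ℕ) xs → sum (map (λ x → f x + g x) xs) ≡ sum (map f xs) + sum (map g xs)
  sum-map-+ f g []       = refl
  sum-map-+ f g (x ∷ xs) rewrite sum-map-+ f g xs =
    ℕ-solve 4 (λ a b c d → a +ℕ b +ℕ (c +ℕ d) =ℕ a +ℕ c +ℕ (b +ℕ d)) refl
      (f x) (g x) (sum (map f xs)) (sum (map g xs))

  sum-map-cong : ∀ {f g : A → ℕ} xs → (∀ {x} → x ∈ xs → f x ≡ g x) → sum (map f xs) ≡ sum (map g xs)
  sum-map-cong []       _   = refl
  sum-map-cong (x ∷ xs) f≡g = cong₂ _+_ (f≡g (here refl)) (sum-map-cong xs (λ x∈ → f≡g (there x∈)))

  sum-map-concatMap : ∀ {B : Set} (f : B → ℕ) (F : A → List B) xs →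
                      sum (map f (concatMap F xs)) ≡ sum (map (λ x → sum (map f (F x))) xs)
  sum-map-concatMap f F []       = refl
  sum-map-concatMap f F (x ∷ xs) = begin
    sum (map f (F x ++ concatMap F xs))                  ≡⟨ cong sum (map-++ f (F x) (concatMap F xs)) ⟩
    sum (map f (F x) ++ map f (concatMap F xs))          ≡⟨ sum-++ (map f (F x)) _ ⟩
    sum (map f (F x)) + sum (map f (concatMap F xs))     ≡⟨ cong (sum (map f (F x)) +_) (sum-map-concatMap f F xs) ⟩
    sum (map f (F x)) + sum (map (λ x → sum (map f (F x))) xs) ∎
    where open ≡-Reasoning

  private
    sum-constant+ : ∀ {B : Set} c (h : B → ℕ) ys → sum (map (λ y → c + h y) ys) ≡ c * length ys + sum (map h ys)
    sum-constant+ c h []       = sym (cong (_+ 0) (*-zeroʳ c))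
    sum-constant+ c h (y ∷ ys) rewrite sum-constant+ c h ys =
      ℕ-solve 4 (λ c a l s → c +ℕ a +ℕ (c *ℕ l +ℕ s) =ℕ c *ℕ (conℕ 1 +ℕ l) +ℕ (a +ℕ s)) refl
        c (h y) (length ys) (sum (map h ys))

  sum-separable : ∀ {B : Set} e (g : A → ℕ) (h : B → ℕ) xs ys →
    sum (map (λ x → sum (map (λ y → e + g x + h y) ys)) xs)
      ≡ e * length xs * length ys + sum (map g xs) * length ys + length xs * sum (map h ys)
  sum-separable e g h []       ys = sym (cong (λ t → t * length ys + 0 + 0) (*-zeroʳ e))
  sum-separable e g h (x ∷ xs) ys rewrite sum-constant+ (e + g x) h ys | sum-separable e g h xs ys =
    ℕ-solve 6 (λ e g l s n t → (e +ℕ g) *ℕ l +ℕ s +ℕ (e *ℕ n *ℕ l +ℕ t *ℕ l +ℕ n *ℕ s)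
                           =ℕ e *ℕ (conℕ 1 +ℕ n) *ℕ l +ℕ (g +ℕ t) *ℕ l +ℕ (conℕ 1 +ℕ n) *ℕ s)
      refl e (g x) (length ys) (sum (map h ys)) (length xs) (sum (map g xs))

count : Series
count n = length (Av231 n)

record Splits (f : List ℕ → ℕ) (e₁ e₂ : ℕ → ℕ) (g h : List ℕ → ℕ) : Set where
  field
    split : ∀ {k m α β} → α ∈ Av231 k → β ∈ Av231 m → f (assemble k α β) ≡ e₁ k * e₂ m + g α + h β

total-suc : ∀ {f e₁ e₂ g h} → Splits f e₁ e₂ g h → ∀ n →
  total f (suc n) ≡ (e₁ ⊙ count ⊛ e₂ ⊙ count) n + ((total g ⊛ count) n + (count ⊛ total h) n)
total-suc {f} {e₁} {e₂} {g} {h} split n = begin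
  total f (suc n)                              ≡⟨ sum-↭ (↭.map⁺ f (Av231-suc↭assembled n)) ⟩
  sum (map f (assembled n))                    ≡⟨ sum-map-concatMap f (assembledFrom n) ks ⟩
  Σ (λ k → sum (map f (assembledFrom n k)))    ≡⟨ sum-map-cong ks (λ {k} _ → by-parts k) ⟩
  Σ (λ k → X k + (Y k + W k))                  ≡⟨ sum-map-+ X (λ k → Y k + W k) ks ⟩
  Σ X + Σ (λ k → Y k + W k)                    ≡⟨ cong (Σ X +_) (sum-map-+ Y W ks) ⟩
  Σ X + (Σ Y + Σ W)                            ∎
  where
  open ≡-Reasoning
  ks : List ℕ
  ks = upTo (suc n)
  Σ : (ℕ → ℕ) → ℕ
  Σ F = sum (map F ks)
  X Y W : ℕ → ℕ
  X k = e₁ k * count k * (e₂ (n ∸ k) * count (n ∸ k))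
  Y k = total g k * count (n ∸ k)
  W k = count k * total h (n ∸ k)
  by-parts : ∀ k → sum (map f (assembledFrom n k)) ≡ X k + (Y k + W k)
  by-parts k = begin
    sum (map f (assembledFrom n k))
      ≡⟨ sum-map-concatMap f (λ α → map (assemble k α) (Av231 (n ∸ k))) (Av231 k) ⟩
    sum (map (λ α → sum (map f (map (assemble k α) (Av231 (n ∸ k))))) (Av231 k))
      ≡⟨ sum-map-cong (Av231 k) (λ {α} α∈ → trans (cong sum (sym (map-∘ (Av231 (n ∸ k)))))
                                                   (sum-map-cong (Av231 (n ∸ k)) (λ β∈ → Splits.split split α∈ β∈))) ⟩
    sum (map (λ α → sum (map (λ β → e₁ k * e₂ (n ∸ k) + g α + h β) (Av231 (n ∸ k)))) (Av231 k))
      ≡⟨ sum-separable (e₁ k * e₂ (n ∸ k)) g h (Av231 k) (Av231 (n ∸ k)) ⟩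
    e₁ k * e₂ (n ∸ k) * count k * count (n ∸ k) + Y k + W k
      ≡⟨ ℕ-solve 6 (λ x y a b u v → x *ℕ y *ℕ a *ℕ b +ℕ u +ℕ v =ℕ x *ℕ a *ℕ (y *ℕ b) +ℕ (u +ℕ v)) refl
                   (e₁ k) (e₂ (n ∸ k)) (count k) (count (n ∸ k)) (Y k) (W k) ⟩
    X k + (Y k + W k) ∎

splits-with : ∀ {f e₁ e₂ g h} →
              (∀ {k m α β} → IsPerm k α → IsPerm m β → f (assemble k α β) ≡ e₁ k * e₂ m + g α + h β) →
              Splits f e₁ e₂ g h
splits-with stat = record
  { split = λ {k} {m} α∈ β∈ → stat (proj₁ (∈-Av231⁻ {k} α∈)) (proj₁ (∈-Av231⁻ {m} β∈)) }

first-letter-splits : ∀ {f e₁ e₂} →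
                      (∀ {k m α β} → IsPerm k α → IsPerm m β → f (assemble k α β) ≡ e₁ k * e₂ m) →
                      Splits f e₁ e₂ (λ _ → 0) (λ _ → 0)
first-letter-splits stat = splits-with λ α-perm β-perm →
  trans (stat α-perm β-perm) (sym (trans (+-identityʳ _) (+-identityʳ _)))

occ2-1-splits : Splits occ2-1 (λ k → k) (λ _ → 1) occ2-1 occ2-1
occ2-1-splits = splits-with λ {k} {_} {α} {β} α-perm β-perm →
  trans (assemble-occ2-1 α-perm β-perm) (cong (λ t → t + occ2-1 α + occ2-1 β) (sym (*-identityʳ k)))

occ1-2-splits : Splits occ1-2 suc (λ m → m) occ1-2 occ1-2
occ1-2-splits = splits-with assemble-occ1-2

occ21-splits : Splits occ21 sign (λ _ → 1) occ21 occ21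
occ21-splits = splits-with λ {k} {_} {α} {β} α-perm β-perm →
  trans (assemble-occ21 α-perm β-perm) (cong (λ t → t + occ21 α + occ21 β) (sym (*-identityʳ (sign k))))

occ12-splits : Splits occ12 (λ _ → 1) sign occ12 occ12
occ12-splits = splits-with λ {_} {m} {α} {β} α-perm β-perm →
  trans (assemble-occ12 α-perm β-perm) (cong (λ t → t + occ12 α + occ12 β) (sym (+-identityʳ (sign m))))

first2-1-splits : Splits first2-1 (λ k → k) (λ _ → 1) (λ _ → 0) (λ _ → 0)
first2-1-splits = first-letter-splits λ {k} α-perm β-perm → trans (assemble-first2-1 α-perm β-perm) (sym (*-identityʳ k))

first1-2-splits : Splits first1-2 (λ _ → 1) (λ m → m) (λ _ → 0) (λ _ → 0)
first1-2-splits = first-letter-splits λ {_} {m} α-perm β-perm → trans (assemble-first1-2 α-perm β-perm) (sym (+-identityʳ m))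

first21-splits : Splits first21 sign (λ _ → 1) (λ _ → 0) (λ _ → 0)
first21-splits = first-letter-splits λ {k} α-perm β-perm → trans (assemble-first21 α-perm β-perm) (sym (*-identityʳ (sign k)))

first12-splits : Splits first12 (λ k → 1 ∸ sign k) sign (λ _ → 0) (λ _ → 0)
first12-splits = first-letter-splits assemble-first12

total-series : ∀ {f e₁ e₂ g h} → Splits f e₁ e₂ g h → f [] ≡ 0 →
               total f ≈ Z ⊛ (e₁ ⊙ count ⊛ e₂ ⊙ count ⊕ (total g ⊛ count ⊕ count ⊛ total h))
total-series split f[]≡0 zero    = trans (+-identityʳ _) f[]≡0
total-series {f} {e₁} {e₂} {g} {h} split f[]≡0 (suc n) = trans (total-suc split n)
  (sym (Z⊛-suc (e₁ ⊙ count ⊛ e₂ ⊙ count ⊕ (total g ⊛ count ⊕ count ⊛ total h)) n))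

total-zero : total (λ _ → 0) ≈ zeroₛ
total-zero n = sum-zeros (Av231 n)
  where
  sum-zeros : (xs : List (List ℕ)) → sum (map (λ _ → 0) xs) ≡ 0
  sum-zeros []       = refl
  sum-zeros (_ ∷ xs) = sum-zeros xs

count-eq : count ≈ one ⊕ Z ⊛ (count ⊛ count)
count-eq zero    = refl
count-eq (suc n) = begin
  count (suc n)
    ≡⟨ sum-ones (Av231 (suc n)) ⟨
  total (λ _ → 1) (suc n)
    ≡⟨ total-suc {e₁ = unit} {e₂ = unit} {g = λ _ → 0} {h = λ _ → 0} (record { split = λ _ _ → refl }) n ⟩
  (unit ⊙ count ⊛ unit ⊙ count ⊕ (total (λ _ → 0) ⊛ count ⊕ count ⊛ total (λ _ → 0))) n
    ≡⟨ simplify n ⟩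
  (count ⊛ count) n
    ≡⟨ Z⊛-suc (count ⊛ count) n ⟨
  (Z ⊛ (count ⊛ count)) (suc n) ∎
  where
  open ≡-Reasoning
  unit : ℕ → ℕ
  unit _ = 1
  sum-ones : (xs : List (List ℕ)) → sum (map (λ _ → 1) xs) ≡ length xs
  sum-ones []       = refl
  sum-ones (_ ∷ xs) = cong suc (sum-ones xs)
  simplify : unit ⊙ count ⊛ unit ⊙ count ⊕ (total (λ _ → 0) ⊛ count ⊕ count ⊛ total (λ _ → 0)) ≈ count ⊛ count
  simplify = ≈-trans (+-cong (⊛-cong (λ n → *-identityˡ (count n)) (λ n → *-identityˡ (count n)))
                             (+-cong (⊛-congˡ count total-zero) (⊛-congʳ count total-zero)))
                     (solve 1 (λ a → a :* a :+ (con 0 :* a :+ a :* con 0) := a :* a) ≈-refl count)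

isZero⊙count : (λ k → 1 ∸ sign k) ⊙ count ≈ one
isZero⊙count zero    = refl
isZero⊙count (suc n) = refl

-- Generating functions of the statistics

module Statistics (b c : Series) (isB : IsB b) (isC : IsC c) where

  open BCIdentities b c isB isC
  open ≈-Reasoning

  count≈c : count ≈ c
  count≈c = guarded-unique one (λ x → x ⊛ x) square-causal count-eq
    (≈-trans isC (solve 2 (λ z c → con 1 :+ z :* c :* c := con 1 :+ z :* (c :* c)) ≈-refl Z c))
    where
    square-causal : Causal (λ x → x ⊛ x)
    square-causal n x y p = ⊛-agree p p n ≤-refl

  one⊙count : (λ _ → 1) ⊙ count ≈ c
  one⊙count n = trans (*-identityˡ (count n)) (count≈c n)

  θcount : θ count ≈ Z ⊛ b ⊛ c ⊛ c
  θcount = ≈-trans (⊙-cong (λ n → n) count≈c) θc≈zbc²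

  -- suc ⊙ c is definitionally c ⊕ θ c
  suc⊙count : suc ⊙ count ≈ b
  suc⊙count = ≈-trans (⊙-cong suc count≈c) (≈-trans (⊕-congʳ c θc≈zbc²) (≈-sym b≈c+zbc²))

  sign⊙count : sign ⊙ count ≈ Z ⊛ c ⊛ c
  sign⊙count zero    = refl
  sign⊙count (suc n) = trans (*-identityˡ (count (suc n))) (trans (count≈c (suc n)) (isC (suc n)))

  linear-statistic : ∀ {X} Q → X ≈ Z ⊛ (Q ⊕ (X ⊛ count ⊕ count ⊛ X)) → X ≈ b ⊛ (Z ⊛ Q)
  linear-statistic {X} Q X-eq = linear-solution (begin
    X
      ≈⟨ X-eq ⟩
    Z ⊛ (Q ⊕ (X ⊛ count ⊕ count ⊛ X))
      ≈⟨ ⊛-congʳ Z (⊕-congʳ Q (+-cong (⊛-congʳ X count≈c) (⊛-congˡ X count≈c))) ⟩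
    Z ⊛ (Q ⊕ (X ⊛ c ⊕ c ⊛ X))
      ≈⟨ solve 4 (λ z q x c → z :* (q :+ (x :* c :+ c :* x)) := z :* q :+ z :* (c :* x :+ c :* x)) ≈-refl Z Q X c ⟩
    Z ⊛ Q ⊕ Z ⊛ (c ⊛ X ⊕ c ⊛ X) ∎)

  first-letter-statistic : ∀ {f e₁ e₂} → Splits f e₁ e₂ (λ _ → 0) (λ _ → 0) → f [] ≡ 0 →
                           total f ≈ Z ⊛ (e₁ ⊙ count ⊛ e₂ ⊙ count)
  first-letter-statistic {f} {e₁} {e₂} split f[]≡0 = begin
    total f
      ≈⟨ total-series split f[]≡0 ⟩
    Z ⊛ (e₁ ⊙ count ⊛ e₂ ⊙ count ⊕ (total (λ _ → 0) ⊛ count ⊕ count ⊛ total (λ _ → 0)))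
      ≈⟨ ⊛-congʳ Z (⊕-congʳ (e₁ ⊙ count ⊛ e₂ ⊙ count)
                             (+-cong (⊛-congˡ count total-zero) (⊛-congʳ count total-zero))) ⟩
    Z ⊛ (e₁ ⊙ count ⊛ e₂ ⊙ count ⊕ (zeroₛ ⊛ count ⊕ count ⊛ zeroₛ))
      ≈⟨ solve 3 (λ z p a → z :* (p :+ (con 0 :* a :+ a :* con 0)) := z :* p)
                 ≈-refl Z (e₁ ⊙ count ⊛ e₂ ⊙ count) count ⟩
    Z ⊛ (e₁ ⊙ count ⊛ e₂ ⊙ count) ∎

  Z²⊛ : ∀ x → Z² ⊛ x ≈ Z ⊛ Z ⊛ x
  Z²⊛ x = ⊛-congˡ x Z²≈Z⊛Z

  inversions : total occ2-1 ≈ Z² ⊛ b ⊛ b ⊛ c ⊛ c ⊛ c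
  inversions = begin
    total occ2-1
      ≈⟨ linear-statistic (θ count ⊛ (λ _ → 1) ⊙ count) (total-series occ2-1-splits refl) ⟩
    b ⊛ (Z ⊛ (θ count ⊛ (λ _ → 1) ⊙ count))
      ≈⟨ ⊛-congʳ b (⊛-congʳ Z (⊛-cong {θ count} θcount one⊙count)) ⟩
    b ⊛ (Z ⊛ (Z ⊛ b ⊛ c ⊛ c ⊛ c))
      ≈⟨ solve 3 (λ z b c → b :* (z :* (z :* b :* c :* c :* c)) := z :* z :* b :* b :* c :* c :* c) ≈-refl Z b c ⟩
    Z ⊛ Z ⊛ b ⊛ b ⊛ c ⊛ c ⊛ c
      ≈⟨ ⊛-congˡ c (⊛-congˡ c (⊛-congˡ c (⊛-congˡ b (Z²⊛ b)))) ⟨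
    Z² ⊛ b ⊛ b ⊛ c ⊛ c ⊛ c ∎

  non-inversions : total occ1-2 ≈ Z² ⊛ b ⊛ b ⊛ b ⊛ c ⊛ c
  non-inversions = begin
    total occ1-2
      ≈⟨ linear-statistic (suc ⊙ count ⊛ θ count) (total-series occ1-2-splits refl) ⟩
    b ⊛ (Z ⊛ (suc ⊙ count ⊛ θ count))
      ≈⟨ ⊛-congʳ b (⊛-congʳ Z (⊛-cong {suc ⊙ count} suc⊙count θcount)) ⟩
    b ⊛ (Z ⊛ (b ⊛ (Z ⊛ b ⊛ c ⊛ c)))
      ≈⟨ solve 3 (λ z b c → b :* (z :* (b :* (z :* b :* c :* c))) := z :* z :* b :* b :* b :* c :* c) ≈-refl Z b c ⟩
    Z ⊛ Z ⊛ b ⊛ b ⊛ b ⊛ c ⊛ c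
      ≈⟨ ⊛-congˡ c (⊛-congˡ c (⊛-congˡ b (⊛-congˡ b (Z²⊛ b)))) ⟨
    Z² ⊛ b ⊛ b ⊛ b ⊛ c ⊛ c ∎

  descents : total occ21 ≈ Z² ⊛ b ⊛ c ⊛ c ⊛ c
  descents = begin
    total occ21
      ≈⟨ linear-statistic (sign ⊙ count ⊛ (λ _ → 1) ⊙ count) (total-series occ21-splits refl) ⟩
    b ⊛ (Z ⊛ (sign ⊙ count ⊛ (λ _ → 1) ⊙ count))
      ≈⟨ ⊛-congʳ b (⊛-congʳ Z (⊛-cong {sign ⊙ count} sign⊙count one⊙count)) ⟩
    b ⊛ (Z ⊛ (Z ⊛ c ⊛ c ⊛ c))
      ≈⟨ solve 3 (λ z b c → b :* (z :* (z :* c :* c :* c)) := z :* z :* b :* c :* c :* c) ≈-refl Z b c ⟩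
    Z ⊛ Z ⊛ b ⊛ c ⊛ c ⊛ c
      ≈⟨ ⊛-congˡ c (⊛-congˡ c (⊛-congˡ c (Z²⊛ b))) ⟨
    Z² ⊛ b ⊛ c ⊛ c ⊛ c ∎

  ascents : total occ12 ≈ Z² ⊛ b ⊛ c ⊛ c ⊛ c
  ascents = begin
    total occ12
      ≈⟨ linear-statistic ((λ _ → 1) ⊙ count ⊛ sign ⊙ count) (total-series occ12-splits refl) ⟩
    b ⊛ (Z ⊛ ((λ _ → 1) ⊙ count ⊛ sign ⊙ count))
      ≈⟨ ⊛-congʳ b (⊛-congʳ Z (⊛-cong {(λ _ → 1) ⊙ count} one⊙count sign⊙count)) ⟩
    b ⊛ (Z ⊛ (c ⊛ (Z ⊛ c ⊛ c)))
      ≈⟨ solve 3 (λ z b c → b :* (z :* (c :* (z :* c :* c))) := z :* z :* b :* c :* c :* c) ≈-refl Z b c ⟩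
    Z ⊛ Z ⊛ b ⊛ c ⊛ c ⊛ c
      ≈⟨ ⊛-congˡ c (⊛-congˡ c (⊛-congˡ c (Z²⊛ b))) ⟨
    Z² ⊛ b ⊛ c ⊛ c ⊛ c ∎

  first-inversions : total first2-1 ≈ Z² ⊛ b ⊛ c ⊛ c ⊛ c
  first-inversions = begin
    total first2-1
      ≈⟨ first-letter-statistic first2-1-splits refl ⟩
    Z ⊛ (θ count ⊛ (λ _ → 1) ⊙ count)
      ≈⟨ ⊛-congʳ Z (⊛-cong {θ count} θcount one⊙count) ⟩
    Z ⊛ (Z ⊛ b ⊛ c ⊛ c ⊛ c)
      ≈⟨ solve 3 (λ z b c → z :* (z :* b :* c :* c :* c) := z :* z :* b :* c :* c :* c) ≈-refl Z b c ⟩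
    Z ⊛ Z ⊛ b ⊛ c ⊛ c ⊛ c
      ≈⟨ ⊛-congˡ c (⊛-congˡ c (⊛-congˡ c (Z²⊛ b))) ⟨
    Z² ⊛ b ⊛ c ⊛ c ⊛ c ∎

  first-non-inversions : total first1-2 ≈ Z² ⊛ b ⊛ c ⊛ c ⊛ c
  first-non-inversions = begin
    total first1-2
      ≈⟨ first-letter-statistic first1-2-splits refl ⟩
    Z ⊛ ((λ _ → 1) ⊙ count ⊛ θ count)
      ≈⟨ ⊛-congʳ Z (⊛-cong {(λ _ → 1) ⊙ count} one⊙count θcount) ⟩
    Z ⊛ (c ⊛ (Z ⊛ b ⊛ c ⊛ c))
      ≈⟨ solve 3 (λ z b c → z :* (c :* (z :* b :* c :* c)) := z :* z :* b :* c :* c :* c) ≈-refl Z b c ⟩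
    Z ⊛ Z ⊛ b ⊛ c ⊛ c ⊛ c
      ≈⟨ ⊛-congˡ c (⊛-congˡ c (⊛-congˡ c (Z²⊛ b))) ⟨
    Z² ⊛ b ⊛ c ⊛ c ⊛ c ∎

  first-descents : total first21 ≈ Z² ⊛ c ⊛ c ⊛ c
  first-descents = begin
    total first21
      ≈⟨ first-letter-statistic first21-splits refl ⟩
    Z ⊛ (sign ⊙ count ⊛ (λ _ → 1) ⊙ count)
      ≈⟨ ⊛-congʳ Z (⊛-cong {sign ⊙ count} sign⊙count one⊙count) ⟩
    Z ⊛ (Z ⊛ c ⊛ c ⊛ c)
      ≈⟨ solve 2 (λ z c → z :* (z :* c :* c :* c) := z :* z :* c :* c :* c) ≈-refl Z c ⟩
    Z ⊛ Z ⊛ c ⊛ c ⊛ c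
      ≈⟨ ⊛-congˡ c (⊛-congˡ c (Z²⊛ c)) ⟨
    Z² ⊛ c ⊛ c ⊛ c ∎

  first-ascents : total first12 ≈ Z² ⊛ c ⊛ c
  first-ascents = begin
    total first12
      ≈⟨ first-letter-statistic first12-splits refl ⟩
    Z ⊛ ((λ k → 1 ∸ sign k) ⊙ count ⊛ sign ⊙ count)
      ≈⟨ ⊛-congʳ Z (⊛-cong {(λ k → 1 ∸ sign k) ⊙ count} isZero⊙count sign⊙count) ⟩
    Z ⊛ (one ⊛ (Z ⊛ c ⊛ c))
      ≈⟨ solve 2 (λ z c → z :* (con 1 :* (z :* c :* c)) := z :* z :* c :* c) ≈-refl Z c ⟩
    Z ⊛ Z ⊛ c ⊛ c
      ≈⟨ ⊛-congˡ c (Z²⊛ c) ⟨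
    Z² ⊛ c ⊛ c ∎

corollary3p2 : (b c : Series) → IsB b → IsC c →
    ((n : ℕ) → total occ2-1 n ≡ (Z² ⊛ b ⊛ b ⊛ c ⊛ c ⊛ c) n)
    × ((n : ℕ) → total occ1-2 n ≡ (Z² ⊛ b ⊛ b ⊛ b ⊛ c ⊛ c) n)
    × ((n : ℕ) → 1 ≤ n →
         (total occ21 n ≡ total occ12 n)
         × (total occ12 n ≡ total first2-1 n)
         × (total first2-1 n ≡ total first1-2 n)
         × (total first1-2 n ≡ bin n))
    × ((n : ℕ) → total occ21 n ≡ (Z² ⊛ b ⊛ c ⊛ c ⊛ c) n)
    × ((n : ℕ) → total occ12 n ≡ (Z² ⊛ b ⊛ c ⊛ c ⊛ c) n)
    × ((n : ℕ) → total first2-1 n ≡ (Z² ⊛ b ⊛ c ⊛ c ⊛ c) n)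
    × ((n : ℕ) → total first1-2 n ≡ (Z² ⊛ b ⊛ c ⊛ c ⊛ c) n)
    × ((n : ℕ) → total first21 n ≡ (Z² ⊛ c ⊛ c ⊛ c) n)
    × ((n : ℕ) → total first12 n ≡ (Z² ⊛ c ⊛ c) n)
corollary3p2 b c isB isC =
  inversions , non-inversions ,
  (λ n _ → trans (descents n) (sym (ascents n))
         , trans (ascents n) (sym (first-inversions n))
         , trans (first-inversions n) (sym (first-non-inversions n))
         , trans (first-non-inversions n) (z²bc³≡bin n)) ,
  descents , ascents , first-inversions , first-non-inversions , first-descents , first-ascents
  where
  open Statistics b c isB isC
  open BinomialCoefficients b c isB isC using (z²bc³≡bin)
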